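{- Let $p$ be a prime, $q$ a power of $p$, $K=\mathbb{F}_q(T)$, $d\geq2$ an integer with $p\nmid d$, $a\in K^\times\setminus\mathbb{F}_q$, $f=\mathrm{ord}_d(q)$ and $\bar f=\mathrm{ord}_{d(h,d^\infty)}(q)$. Assume that $f_{u,v}=\mathrm{ord}_{dv}(q)$ for all $u\mid d$ and $v\mid d^\infty$. Then for each $w\mid d^\infty$, \[ \delta_w=\begin{cases}\displaystyle\sum_{u\mid d}\frac{\mu(u)\,(dh,u^\infty)}{u\,(q^{\bar f}-1,u^\infty)\,(\nu,u^\infty)\,\eta(\nu,u)},&\text{if }fw=\bar f\nu\text{ for some }\nu\mid d^\infty;\\ 0,&\text{otherwise}.\end{cases} \]
   Context: $w\mid d^\infty$ means $w$ is a positive integer dividing a power of $d$; $(k,m^\infty)=\prod_{l\mid m}l^{v_l(k)}$. Write $a=\lambda\tilde a$, $\lambda\in\mathbb{F}_q^\times$, with $\tilde a=\tilde f/\tilde g$ for $a=f/g$, $f,g\in\mathbb{F}_q[T]$, $\tilde f,\tilde g$ the monic parts; $h$ is the largest integer $t\ge1$ with $\tilde a\in(K^\times)^t$. For $r\mid m$, $p\nmid m$, $\mathbb{F}_{m,r}$ is the constant field of $K(\zeta_m,a^{1/r})$ ($\zeta_m$ a primitive $m$-th root of unity in $\bar{\mathbb{F}}_q$), and $f_{u,v}=[\mathbb{F}_{dv,uv}:\mathbb{F}_q]$. $e_n=\big(\frac{q^n-1}{d},d^\infty\big)$ for $f\mid n$. For $w\mid d^\infty$, $\delta_w=\sum_{v\mid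 e_{fw}}\sum_{u\mid d}\frac{\mu(u)(uv,h)}{uv}[f_{u,v}\mid fw]$, $[\cdot]$ the Iverson bracket. Let $\mathcal{P}$ be the proposition "$2\,\|\,d$, $q\equiv3\pmod4$ and $f$ is odd". Define $\eta(m,n)=2^{v_2(q^{\bar f}+1)-1}$ if $2\mid(m,n)$ and $\mathcal{P}$ holds, and $\eta(m,n)=1$ otherwise. -}

module Defs where

open import Data.Nat using (ℕ; zero; suc; _+_; _*_; _∸_; _^_; _≤_; _<_; _%_)
import Data.Nat as ℕ
open import Data.Nat.Divisibility using (_∣_; _∣?_)
open import Data.Nat.GCD using (gcd)
open import Data.Nat.Primality using (Prime; prime?)
open import Data.Bool using (Bool; true; false; if_then_else_; _∧_; not)
open import Data.List using (List; []; _∷_; map; filter; foldr; length; upTo)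
open import Data.Bool.ListAction using (any)
open import Data.Integer using (ℤ; +_; -_)
import Data.Integer as ℤ
open import Data.Rational using (ℚ; 0ℚ)
import Data.Rational as ℚ
open import Data.Product using (Σ; _×_)
open import Relation.Nullary using (¬_; does)
open import Relation.Binary.PropositionalEquality using (_≡_)

-- w ∣ d^∞ : w divides some power of d  (w is then automatically positive when d ≥ 1)
_∣_^∞ : ℕ → ℕ → Set
w ∣ d ^∞ = Σ ℕ (λ k → w ∣ d ^ k)

divisors : ℕ → List ℕ
divisors n = filter (λ k → k ∣? n) (map suc (upTo n))

primeDivisors : ℕ → List ℕ
primeDivisors n = filter prime? (divisors n)

_div_ : ℕ → ℕ → ℕ
m div zero = 0
m div (suc k) = m ℕ./ suc k

-- l-adic valuation v_l(k) (for l ≥ 2, k ≥ 1; conventionally 0 otherwise), by recursion with fuel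
valF : ℕ → ℕ → ℕ → ℕ
valF zero l k = 0
valF (suc fuel) zero k = 0
valF (suc fuel) (suc zero) k = 0
valF (suc fuel) (suc (suc l)) zero = 0
valF (suc fuel) (suc (suc l)) (suc k) =
  if does (suc (suc l) ∣? suc k)
  then suc (valF fuel (suc (suc l)) (suc k ℕ./ suc (suc l)))
  else 0

v : ℕ → ℕ → ℕ
v l k = valF k l k

-- (k, m^∞) = ∏_{l ∣ m prime} l^{v_l(k)}
coprimePart : ℕ → ℕ → ℕ
coprimePart k m = foldr (λ l acc → l ^ v l k * acc) 1 (primeDivisors m)

μ : ℕ → ℤ
μ n = if any (λ l → does (l * l ∣? n)) (primeDivisors n)
      then + 0
      else (if does (2 ∣? length (primeDivisors n)) then + 1 else - (+ 1))

frac : ℤ → ℕ → ℚ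
frac z zero = 0ℚ
frac z (suc n) = z ℚ./ suc n

sumℚ : List ℚ → ℚ
sumℚ = foldr ℚ._+_ 0ℚ

IsOrd : ℕ → ℕ → ℕ → Set
IsOrd m q o = (1 ≤ o) × (m ∣ (q ^ o ∸ 1)) × (∀ n → 1 ≤ n → n < o → ¬ (m ∣ (q ^ n ∸ 1)))

e : ℕ → ℕ → ℕ → ℕ
e q d n = coprimePart ((q ^ n ∸ 1) div d) d

-- δ_w, where F u v stands for f_{u,v} = [F_{dv,uv} : F_q]
δ : (q d h f : ℕ) → (F : ℕ → ℕ → ℕ) → ℕ → ℚ
δ q d h f F w =
  sumℚ (map (λ v' →
    sumℚ (map (λ u →
      if does (F u v' ∣? (f * w))
      then frac (μ u ℤ.* + gcd (u * v') h) (u * v')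
      else 0ℚ) (divisors d))) (divisors (e q d (f * w))))

𝒫 : (q d f : ℕ) → Bool
𝒫 q d f = does (2 ∣? d) ∧ not (does (4 ∣? d)) ∧ does ((q % 4) ℕ.≟ 3) ∧ not (does (2 ∣? f))

η : (q d f fbar m n : ℕ) → ℕ
η q d f fbar m n =
  if does (2 ∣? gcd m n) ∧ 𝒫 q d f
  then 2 ^ (v 2 (q ^ fbar + 1) ∸ 1)
  else 1

-- the right-hand side in the case f w = f̄ ν
rhs : (q d h f fbar ν : ℕ) → ℚ
rhs q d h f fbar ν =
  sumℚ (map (λ u →
    frac (μ u ℤ.* + coprimePart (d * h) u)
         (u * coprimePart (q ^ fbar ∸ 1) u * coprimePart ν u * η q d f fbar ν u))
    (divisors d))

-- Put K = (q^{fw} − 1)/d, so that e_{fw} = (K, d^∞). Since f_{u,v} = ord_{dv}(q) and dv ∣ dK = q^{fw} − 1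
-- for every v ∣ (K, d^∞), all Iverson brackets in δ_w hold and δ_w = Σ_{v ∣ (K,d^∞)} Σ_{u ∣ d} μ(u)(uv,h)/(uv).
-- As a function of d this double sum is multiplicative, and over a prime power l^a (a ≥ 1) it telescopes to
-- 1 − (l^{b+1}, h)/l^{b+1} with b = v_l(K). If b < v_l(h) for some l ∣ d this factor vanishes. Otherwise
-- (h, d^∞) ∣ K, so d(h, d^∞) ∣ q^{fw} − 1, f̄ ∣ fw and fw = f̄ν with ν ∣ w. Then q^{fw} − 1 = x^ν − 1 for
-- x = q^{f̄}, and lifting the exponent gives v_l(d) + b = v_l(x − 1) + v_l(ν) + e with l^e = η(ν, l). This
-- identifies the local factor with 1 − l^{v_l(dh)}/(l (x − 1, l^∞)(ν, l^∞) η(ν, l)), the factor at l of the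
-- multiplicative sum on the right-hand side.

module Submission where

open import Algebra.Structures using (IsCommutativeMonoid)
open import Data.Product using (∃; ∃-syntax; _×_; _,_; proj₁; proj₂; uncurry)
open import Data.Sum using (_⊎_; inj₁; inj₂; [_,_]′)
import Data.Sum as Sum
open import Data.Empty using (⊥; ⊥-elim)
open import Function using (id; _∘_; _⇔_; mk⇔)
open import Relation.Nullary using (¬_; Dec; yes; no; does)
open import Relation.Binary.PropositionalEquality hiding ([_])
open import Defs

module ListFold {A : Set} {_∙_ : A → A → A} {ε : A} (isCM : IsCommutativeMonoid _≡_ _∙_ ε) where

  open import Data.List using (List; []; _∷_; foldr; _++_)
  open import Data.List.Relation.Binary.Permutation.Propositional using (_↭_; ↭⇒↭ₛ)
  import Data.List.Relation.Binary.Permutation.Setoid.Properties as ↭ₛ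
  open IsCommutativeMonoid isCM using (assoc; identityˡ)

  fold : List A → A
  fold = foldr _∙_ ε

  fold-++ : ∀ xs ys → fold (xs ++ ys) ≡ fold xs ∙ fold ys
  fold-++ []       ys = sym (identityˡ (fold ys))
  fold-++ (x ∷ xs) ys = trans (cong (x ∙_) (fold-++ xs ys)) (sym (assoc x (fold xs) (fold ys)))

  fold-↭ : ∀ {xs ys} → xs ↭ ys → fold xs ≡ fold ys
  fold-↭ p = ↭ₛ.foldr-commMonoid (setoid A) isCM (↭⇒↭ₛ p)

module ListPermutation where

  open import Data.List using (List)
  open import Data.List.Membership.Propositional using (_∈_)
  open import Data.List.Membership.Propositional.Properties.WithK using (unique∧set⇒bag)
  open import Data.List.Relation.Unary.Unique.Propositional using (Unique)
  open import Data.List.Relation.Binary.Permutation.Propositional using (_↭_)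
  open import Data.List.Relation.Binary.BagAndSetEquality using (∼bag⇒↭)

  unique-sameElements⇒↭ : {A : Set} {xs ys : List A} → Unique xs → Unique ys →
    (∀ {x} → x ∈ xs → x ∈ ys) → (∀ {x} → x ∈ ys → x ∈ xs) → xs ↭ ys
  unique-sameElements⇒↭ xs! ys! to from = ∼bag⇒↭ (unique∧set⇒bag xs! ys! (mk⇔ to from))

module Sums where

  open import Data.Nat using (ℕ; zero; suc; _<_; s≤s; z≤n)
  open import Data.Rational using (ℚ; 0ℚ; _+_; _*_; _-_)
  import Data.Rational.Properties as ℚ
  open import Data.List using (List; []; _∷_; map; _++_; cartesianProduct; applyUpTo)
  open import Data.List.Properties using (map-++; map-∘)
  open import Data.List.Membership.Propositional using (_∈_)
  open import Data.List.Membership.Propositional.Properties using (∈-map⁺; ∈-map⁻)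
  open import Data.List.Relation.Unary.Any using (here; there)
  open import Data.List.Relation.Unary.AllPairs using ([]; _∷_)
  import Data.List.Relation.Unary.All as All
  import Data.List.Relation.Unary.All.Properties as All
  open import Data.List.Relation.Unary.Unique.Propositional using (Unique)
  open import Data.List.Relation.Binary.Permutation.Propositional using (_↭_)
  open import Data.List.Relation.Binary.Permutation.Propositional.Properties using (map⁺)
  open import Data.Rational.Solver using (module +-*-Solver)
  open ListPermutation
  open ListFold ℚ.+-0-isCommutativeMonoid using (fold-++; fold-↭)

  ∑ : {A : Set} → List A → (A → ℚ) → ℚ
  ∑ xs F = sumℚ (map F xs)

  syntax ∑ xs (λ x → F) = ∑[ x ← xs ] F

  ∑∣ : ℕ → (ℕ → ℚ) → ℚ
  ∑∣ n F = ∑ (divisors n) F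

  syntax ∑∣ n (λ u → F) = ∑[ u ∣ n ] F

  ∑< : ℕ → (ℕ → ℚ) → ℚ
  ∑< zero    F = 0ℚ
  ∑< (suc n) F = F 0 + ∑< n (F ∘ suc)

  syntax ∑< n (λ i → F) = ∑[ i < n ] F

  private variable A B : Set

  ∑-cong : ∀ (xs : List A) {F G : A → ℚ} → (∀ {x} → x ∈ xs → F x ≡ G x) → ∑ xs F ≡ ∑ xs G
  ∑-cong []       eq = refl
  ∑-cong (x ∷ xs) eq = cong₂ _+_ (eq (here refl)) (∑-cong xs (eq ∘ there))

  ∑-↭ : ∀ {xs ys : List A} (F : A → ℚ) → xs ↭ ys → ∑ xs F ≡ ∑ ys F
  ∑-↭ F p = fold-↭ (map⁺ F p)

  ∑-*ˡ : ∀ (xs : List A) c (F : A → ℚ) → c * ∑ xs F ≡ ∑[ x ← xs ] (c * F x)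
  ∑-*ˡ []       c F = ℚ.*-zeroʳ c
  ∑-*ˡ (x ∷ xs) c F = trans (ℚ.*-distribˡ-+ c (F x) (∑ xs F)) (cong (c * F x +_) (∑-*ˡ xs c F))

  ∑-*-∑ : (xs : List A) (ys : List B) (F : A → ℚ) (G : B → ℚ) →
    ∑ xs F * ∑ ys G ≡ ∑[ x ← xs ] ∑[ y ← ys ] (F x * G y)
  ∑-*-∑ xs ys F G = begin
    ∑ xs F * ∑ ys G                   ≡⟨ ℚ.*-comm (∑ xs F) (∑ ys G) ⟩
    ∑ ys G * ∑ xs F                   ≡⟨ ∑-*ˡ xs (∑ ys G) F ⟩
    ∑[ x ← xs ] (∑ ys G * F x)        ≡⟨ ∑-cong xs (λ {x} _ → trans (ℚ.*-comm (∑ ys G) (F x)) (∑-*ˡ ys (F x) G)) ⟩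
    ∑[ x ← xs ] ∑[ y ← ys ] (F x * G y) ∎
    where open ≡-Reasoning

  ∑-cartesianProduct : (xs : List A) (ys : List B) (F : A → B → ℚ) →
    ∑ (cartesianProduct xs ys) (uncurry F) ≡ ∑[ x ← xs ] ∑ ys (F x)
  ∑-cartesianProduct []       ys F = refl
  ∑-cartesianProduct (x ∷ xs) ys F = begin
    sumℚ (map (uncurry F) (map (x ,_) ys ++ cartesianProduct xs ys))
      ≡⟨ cong sumℚ (map-++ (uncurry F) (map (x ,_) ys) (cartesianProduct xs ys)) ⟩
    sumℚ (map (uncurry F) (map (x ,_) ys) ++ map (uncurry F) (cartesianProduct xs ys))
      ≡⟨ fold-++ (map (uncurry F) (map (x ,_) ys)) (map (uncurry F) (cartesianProduct xs ys)) ⟩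
    sumℚ (map (uncurry F) (map (x ,_) ys)) + ∑ (cartesianProduct xs ys) (uncurry F)
      ≡⟨ cong₂ _+_ (cong sumℚ (sym (map-∘ ys))) (∑-cartesianProduct xs ys F) ⟩
    ∑ ys (F x) + ∑[ x ← xs ] ∑ ys (F x) ∎
    where open ≡-Reasoning

  map⁺-injectiveOn : (g : A → B) {xs : List A} → (∀ {a b} → a ∈ xs → b ∈ xs → g a ≡ g b → a ≡ b) →
    Unique xs → Unique (map g xs)
  map⁺-injectiveOn g {[]}     inj []           = []
  map⁺-injectiveOn g {x ∷ xs} inj (x∉ ∷ xs!) =
    All.map⁺ (All.tabulate (λ y∈ gx≡gy → All.lookup x∉ y∈ (inj (here refl) (there y∈) gx≡gy)))
    ∷ map⁺-injectiveOn g (λ a b → inj (there a) (there b)) xs!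

  ∑-reindex : {xs : List A} {ys : List B} (g : A → B) (F : B → ℚ) → Unique xs → Unique ys →
    (∀ {a b} → a ∈ xs → b ∈ xs → g a ≡ g b → a ≡ b) →
    (∀ {a} → a ∈ xs → g a ∈ ys) → (∀ {c} → c ∈ ys → ∃[ a ] a ∈ xs × g a ≡ c) →
    ∑[ a ← xs ] F (g a) ≡ ∑ ys F
  ∑-reindex {xs = xs} {ys} g F xs! ys! inj into onto =
    trans (cong sumℚ (map-∘ xs)) (∑-↭ F (unique-sameElements⇒↭ (map⁺-injectiveOn g inj xs!) ys! to from))
    where
    to : ∀ {c} → c ∈ map g xs → c ∈ ys
    to c∈ with ∈-map⁻ g c∈
    ... | a , a∈ , refl = into a∈
    from : ∀ {c} → c ∈ ys → c ∈ map g xs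
    from c∈ with onto c∈
    ... | a , a∈ , refl = ∈-map⁺ g a∈

  ∑-applyUpTo : ∀ (f : ℕ → ℕ) n (G : ℕ → ℚ) → ∑ (applyUpTo f n) G ≡ ∑[ i < n ] G (f i)
  ∑-applyUpTo f zero    G = refl
  ∑-applyUpTo f (suc n) G = cong (G (f 0) +_) (∑-applyUpTo (f ∘ suc) n G)

  ∑<-cong : ∀ n {F G : ℕ → ℚ} → (∀ i → i < n → F i ≡ G i) → ∑< n F ≡ ∑< n G
  ∑<-cong zero    eq = refl
  ∑<-cong (suc n) eq = cong₂ _+_ (eq 0 (s≤s z≤n)) (∑<-cong n (λ i i<n → eq (suc i) (s≤s i<n)))

  ∑<-0 : ∀ n → ∑[ i < n ] 0ℚ ≡ 0ℚ
  ∑<-0 zero    = refl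
  ∑<-0 (suc n) = trans (ℚ.+-identityˡ _) (∑<-0 n)

  ∑<-telescope : ∀ n (T : ℕ → ℚ) → ∑[ j < n ] (T j - T (suc j)) ≡ T 0 - T n
  ∑<-telescope zero    T = sym (ℚ.+-inverseʳ (T 0))
  ∑<-telescope (suc n) T = trans (cong (T 0 - T 1 +_) (∑<-telescope n (T ∘ suc))) (cancel (T 0) (T 1) (T (suc n)))
    where
    open +-*-Solver
    cancel : ∀ a b c → (a - b) + (b - c) ≡ a - c
    cancel = solve 3 (λ a b c → (a :- b) :+ (b :- c) := a :- c) refl

module Valuation where

  open import Data.Nat
  open import Data.Nat.Properties
  open import Data.Nat.Divisibility
  open import Data.Nat.DivMod using (_/_; m/n*n≡m)
  open import Data.Nat.Primality using (Prime; euclidsLemma; prime⇒nonTrivial)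
  open import Algebra.Properties.CommutativeSemigroup *-commutativeSemigroup using () renaming (interchange to *-interchange)
  open import Data.Bool using (if_then_else_)

  ^>0 : ∀ {m} n → 1 ≤ m → 1 ≤ m ^ n
  ^>0 zero    _   = s≤s z≤n
  ^>0 (suc n) m>0 = *-mono-≤ m>0 (^>0 n m>0)

  m≤m^n : ∀ {x} n → 1 ≤ x → 1 ≤ n → x ≤ x ^ n
  m≤m^n {x} (suc n) x>0 _ = subst (_≤ x * x ^ n) (*-identityʳ x) (*-monoʳ-≤ x (^>0 n x>0))

  prime⇒≥2 : ∀ {l} → Prime l → 2 ≤ l
  prime⇒≥2 {l} pl = nonTrivial⇒n>1 l {{prime⇒nonTrivial pl}}

  primePower≥2 : ∀ {p k} → Prime p → 1 ≤ k → 2 ≤ p ^ k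
  primePower≥2 {p} {k} pp k>0 = ≤-trans (prime⇒≥2 pp) (m≤m^n k (≤-trans (s≤s z≤n) (prime⇒≥2 pp)) k>0)

  ≥2⇒∤1 : ∀ {l} → 2 ≤ l → ¬ (l ∣ 1)
  ≥2⇒∤1 (s≤s (s≤s _)) l∣1 with ∣1⇒≡1 l∣1
  ... | ()

  ∤⇒>0 : ∀ {l r} → ¬ (l ∣ r) → 1 ≤ r
  ∤⇒>0 {r = zero}  l∤0 = ⊥-elim (l∤0 (divides 0 refl))
  ∤⇒>0 {r = suc r} _   = s≤s z≤n

  valF-decomposition : ∀ fuel l k → 2 ≤ l → 1 ≤ k → k ≤ fuel →
    ∃[ r ] k ≡ l ^ valF fuel l k * r × ¬ (l ∣ r)
  valF-decomposition (suc fuel) (suc zero) k (s≤s ()) _ _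
  valF-decomposition (suc fuel) (suc (suc l)) (suc k) _ _ k≤ = step (L ∣? suc k)
    where
    L = suc (suc l)
    step : (L∣?k : Dec (L ∣ suc k)) →
      ∃[ r ] suc k ≡ L ^ (if does L∣?k then suc (valF fuel L (suc k / L)) else 0) * r × ¬ (L ∣ r)
    step (no L∤k)  = suc k , sym (+-identityʳ (suc k)) , L∤k
    step (yes L∣k) = r , k≡ , L∤r
      where
      m = suc k / L
      mL≡k : m * L ≡ suc k
      mL≡k = m/n*n≡m L∣k
      m>0 : 1 ≤ m
      m>0 = n≢0⇒n>0 (λ m≡0 → 0≢1+n (trans (sym (cong (_* L) m≡0)) mL≡k))
      m<k : m < suc k
      m<k = subst (m <_) mL≡k (m<m*n m L {{>-nonZero m>0}} (s≤s (s≤s z≤n)))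
      IH = valF-decomposition fuel L m (s≤s (s≤s z≤n)) m>0 (≤-pred (≤-trans m<k k≤))
      r = proj₁ IH
      L∤r = proj₂ (proj₂ IH)
      k≡ : suc k ≡ L * L ^ valF fuel L m * r
      k≡ = begin
        suc k                       ≡⟨ sym mL≡k ⟩
        m * L                       ≡⟨ cong (_* L) (proj₁ (proj₂ IH)) ⟩
        L ^ valF fuel L m * r * L   ≡⟨ *-comm (L ^ valF fuel L m * r) L ⟩
        L * (L ^ valF fuel L m * r) ≡⟨ sym (*-assoc L (L ^ valF fuel L m) r) ⟩
        L * L ^ valF fuel L m * r   ∎
        where open ≡-Reasoning

  v-decomposition : ∀ {l k} → 2 ≤ l → 1 ≤ k → ∃[ r ] k ≡ l ^ v l k * r × ¬ (l ∣ r)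
  v-decomposition {l} {k} l≥2 k>0 = valF-decomposition k l k l≥2 k>0 ≤-refl

  ^*-unique : ∀ {l} i j {r s} → 2 ≤ l → l ^ i * r ≡ l ^ j * s → ¬ (l ∣ r) → ¬ (l ∣ s) → i ≡ j
  ^*-unique zero    zero    _   _  _   _   = refl
  ^*-unique {l} zero (suc j) {r} {s} _ eq l∤r _ =
    ⊥-elim (l∤r (divides (l ^ j * s) (trans (sym (+-identityʳ r)) (trans eq (trans (*-assoc l (l ^ j) s) (*-comm l _))))))
  ^*-unique {l} (suc i) zero {r} {s} _ eq _ l∤s =
    ⊥-elim (l∤s (divides (l ^ i * r) (trans (sym (+-identityʳ s)) (trans (sym eq) (trans (*-assoc l (l ^ i) r) (*-comm l _))))))
  ^*-unique {suc l} (suc i) (suc j) {r} {s} l≥2 eq l∤r l∤s = cong suc (^*-unique i j l≥2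
    (*-cancelˡ-≡ _ _ (suc l) (trans (sym (*-assoc (suc l) (suc l ^ i) r)) (trans eq (*-assoc (suc l) (suc l ^ j) s)))) l∤r l∤s)

  v-unique : ∀ {l k} i {r} → 2 ≤ l → k ≡ l ^ i * r → ¬ (l ∣ r) → v l k ≡ i
  v-unique {l} i l≥2 k≡ l∤r
    with s , k≡′ , l∤s ← v-decomposition l≥2 (subst (1 ≤_) (sym k≡) (*-mono-≤ (^>0 i (≤-trans (s≤s z≤n) l≥2)) (∤⇒>0 l∤r)))
    = ^*-unique _ i l≥2 (trans (sym k≡′) k≡) l∤s l∤r

  v-^ : ∀ {l} i → 2 ≤ l → v l (l ^ i) ≡ i
  v-^ {l} i l≥2 = v-unique i l≥2 (sym (*-identityʳ (l ^ i))) (≥2⇒∤1 l≥2)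

  v-self : ∀ {l} → 2 ≤ l → v l l ≡ 1
  v-self {l} l≥2 = trans (cong (v l) (sym (*-identityʳ l))) (v-^ 1 l≥2)

  v≡0 : ∀ {l a} → 2 ≤ l → ¬ (l ∣ a) → v l a ≡ 0
  v≡0 l≥2 l∤a = v-unique 0 l≥2 (sym (+-identityʳ _)) l∤a

  v-* : ∀ {l} a b → Prime l → 1 ≤ a → 1 ≤ b → v l (a * b) ≡ v l a + v l b
  v-* {l} a b pl a>0 b>0
    with r , a≡ , l∤r ← v-decomposition (prime⇒≥2 pl) a>0
       | s , b≡ , l∤s ← v-decomposition (prime⇒≥2 pl) b>0
    = v-unique (v l a + v l b) (prime⇒≥2 pl) ab≡ l∤rs
    where
    l∤rs : ¬ (l ∣ r * s)
    l∤rs l∣rs = [ l∤r , l∤s ]′ (euclidsLemma r s pl l∣rs)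
    ab≡ : a * b ≡ l ^ (v l a + v l b) * (r * s)
    ab≡ = begin
      a * b                                ≡⟨ cong₂ _*_ a≡ b≡ ⟩
      l ^ v l a * r * (l ^ v l b * s)      ≡⟨ *-interchange (l ^ v l a) r (l ^ v l b) s ⟩
      l ^ v l a * l ^ v l b * (r * s)      ≡⟨ cong (_* (r * s)) (sym (^-distribˡ-+-* l (v l a) (v l b))) ⟩
      l ^ (v l a + v l b) * (r * s)        ∎
      where open ≡-Reasoning

  ^v∣ : ∀ {l k} → 2 ≤ l → 1 ≤ k → l ^ v l k ∣ k
  ^v∣ {l} {k} l≥2 k>0 with r , k≡ , _ ← v-decomposition l≥2 k>0 = divides r (trans k≡ (*-comm (l ^ v l k) r))

  ^-monoʳ-∣ : ∀ l {i j} → i ≤ j → l ^ i ∣ l ^ j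
  ^-monoʳ-∣ l {i} i≤j with o , refl ← m≤n⇒∃[o]m+o≡n i≤j = divides (l ^ o) (trans (^-distribˡ-+-* l i o) (*-comm (l ^ i) _))

  ^∣⇒≤v : ∀ {l k j} → 2 ≤ l → 1 ≤ k → l ^ j ∣ k → j ≤ v l k
  ^∣⇒≤v {l} {k} {j} l≥2 k>0 lʲ∣k with j ≤? v l k
  ... | yes j≤v = j≤v
  ... | no  j≰v with r , k≡ , l∤r ← v-decomposition l≥2 k>0 = ⊥-elim (l∤r l∣r)
    where
    instance _ = m^n≢0 l (v l k) {{>-nonZero (≤-trans (s≤s z≤n) l≥2)}}
    l∣r : l ∣ r
    l∣r = *-cancelˡ-∣ (l ^ v l k) (subst (_∣ l ^ v l k * r) (*-comm l _)
            (∣-trans (^-monoʳ-∣ l (≰⇒> j≰v)) (subst (l ^ j ∣_) k≡ lʲ∣k)))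

  ≤v⇒^∣ : ∀ {l k j} → 2 ≤ l → 1 ≤ k → j ≤ v l k → l ^ j ∣ k
  ≤v⇒^∣ {l} l≥2 k>0 j≤v = ∣-trans (^-monoʳ-∣ l j≤v) (^v∣ l≥2 k>0)

  ∣⇒v≥1 : ∀ {l k} → 2 ≤ l → 1 ≤ k → l ∣ k → 1 ≤ v l k
  ∣⇒v≥1 {l} {k} l≥2 k>0 l∣k = ^∣⇒≤v l≥2 k>0 (subst (_∣ k) (sym (*-identityʳ l)) l∣k)

module PrimeFactors where

  open import Data.Nat
  open import Data.Nat.Properties
  open import Data.Nat.Divisibility
  open import Data.Nat.GCD
  open import Data.Nat.Coprimality using (Coprime; coprime-divisor; coprime⇒gcd≡1)
  import Data.Nat.Coprimality as Coprime
  open import Data.Nat.Primality using (Prime; prime?; prime[2]; euclidsLemma; prime⇒irreducible)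
  open import Data.Nat.Primality.Factorisation using (factorise)
  open import Data.Nat.ListAction using (product)
  open import Data.List using (List; []; _∷_; [_]; map; upTo; _++_)
  open import Data.List.Membership.Propositional using (_∈_)
  open import Data.List.Membership.Propositional.Properties
  open import Data.List.Relation.Unary.All using ([]; _∷_)
  open import Data.List.Relation.Unary.Any using (here)
  open import Data.List.Relation.Unary.Unique.Propositional using (Unique)
  import Data.List.Relation.Unary.Unique.Propositional.Properties as Unique
  open import Data.List.Relation.Binary.Permutation.Propositional using (_↭_)
  open ListPermutation
  open Valuation

  ∈divisors⁻ : ∀ {n k} → k ∈ divisors n → k ∣ n × 1 ≤ k
  ∈divisors⁻ {n} k∈ with k∈′ , k∣n ← ∈-filter⁻ (_∣? n) {xs = map suc (upTo n)} k∈
    with _ , _ , refl ← ∈-map⁻ suc k∈′ = k∣n , s≤s z≤n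

  ∈divisors⁺ : ∀ {n k} → 1 ≤ n → k ∣ n → k ∈ divisors n
  ∈divisors⁺ {suc n} {zero}  _ 0∣n = ⊥-elim (0≢1+n (sym (0∣⇒≡0 0∣n)))
  ∈divisors⁺ {suc n} {suc k} _ k∣n = ∈-filter⁺ (_∣? suc n) (∈-map⁺ suc (∈-upTo⁺ (∣⇒≤ k∣n))) k∣n

  divisors-unique : ∀ n → Unique (divisors n)
  divisors-unique n = Unique.filter⁺ (_∣? n) (Unique.map⁺ suc-injective (Unique.upTo⁺ n))

  ∈primeDivisors⁻ : ∀ {n l} → l ∈ primeDivisors n → Prime l × l ∣ n
  ∈primeDivisors⁻ {n} l∈ with l∈′ , pl ← ∈-filter⁻ prime? {xs = divisors n} l∈ = pl , proj₁ (∈divisors⁻ l∈′)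

  ∈primeDivisors⁺ : ∀ {n l} → 1 ≤ n → Prime l → l ∣ n → l ∈ primeDivisors n
  ∈primeDivisors⁺ n>0 pl l∣n = ∈-filter⁺ prime? (∈divisors⁺ n>0 l∣n) pl

  primeDivisors-unique : ∀ n → Unique (primeDivisors n)
  primeDivisors-unique n = Unique.filter⁺ prime? (divisors-unique n)

  ∃primeFactor : ∀ n → 2 ≤ n → ∃[ p ] Prime p × p ∣ n
  ∃primeFactor (suc zero) (s≤s ())
  ∃primeFactor n@(suc (suc _)) _ with factorise n
  ... | record { factors = p ∷ ps ; isFactorisation = n≡ ; factorsPrime = pp ∷ _ } =
    p , pp , divides (product ps) (trans n≡ (*-comm p (product ps)))

  prime∣prime⇒≡ : ∀ {p l} → Prime p → Prime l → p ∣ l → p ≡ l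
  prime∣prime⇒≡ pp pl p∣l with prime⇒irreducible pl p∣l
  ... | inj₂ p≡l = p≡l
  ... | inj₁ refl with s≤s () ← prime⇒≥2 pp

  prime∣^⇒∣ : ∀ {p l} a → Prime p → p ∣ l ^ a → p ∣ l
  prime∣^⇒∣ zero    pp p∣1 = ⊥-elim (≥2⇒∤1 (prime⇒≥2 pp) p∣1)
  prime∣^⇒∣ {l = l} (suc a) pp p∣lᵃ⁺¹ = [ id , prime∣^⇒∣ a pp ]′ (euclidsLemma l (l ^ a) pp p∣lᵃ⁺¹)

  prime∣primePower⇒≡ : ∀ {p l} a → Prime p → Prime l → p ∣ l ^ a → p ≡ l
  prime∣primePower⇒≡ a pp pl p∣lᵃ = prime∣prime⇒≡ pp pl (prime∣^⇒∣ a pp p∣lᵃ)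

  noCommonPrime⇒coprime : ∀ {m n} → (∀ {p} → Prime p → p ∣ m → p ∣ n → ⊥) → Coprime m n
  noCommonPrime⇒coprime noCommon {zero}  (0∣m , 0∣n) with refl ← 0∣⇒≡0 0∣m | refl ← 0∣⇒≡0 0∣n
    = ⊥-elim (noCommon prime[2] (divides 0 refl) (divides 0 refl))
  noCommonPrime⇒coprime noCommon {suc zero} _ = refl
  noCommonPrime⇒coprime noCommon {suc (suc d)} (d∣m , d∣n)
    with p , pp , p∣d ← ∃primeFactor (suc (suc d)) (s≤s (s≤s z≤n))
    = ⊥-elim (noCommon pp (∣-trans p∣d d∣m) (∣-trans p∣d d∣n))

  coprime-∣ : ∀ {m n i j} → Coprime m n → i ∣ m → j ∣ n → Coprime i j
  coprime-∣ m⊥n i∣m j∣n (c∣i , c∣j) = m⊥n (∣-trans c∣i i∣m , ∣-trans c∣j j∣n)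

  coprime⇒prime∤ : ∀ {m n p} → Coprime m n → Prime p → p ∣ m → ¬ (p ∣ n)
  coprime⇒prime∤ m⊥n pp p∣m p∣n with s≤s () ← subst (2 ≤_) (m⊥n (p∣m , p∣n)) (prime⇒≥2 pp)

  coprime-^ : ∀ {l m} a → Prime l → ¬ (l ∣ m) → Coprime (l ^ a) m
  coprime-^ a pl l∤m = noCommonPrime⇒coprime λ pp p∣lᵃ p∣m →
    l∤m (subst (_∣ _) (prime∣primePower⇒≡ a pp pl p∣lᵃ) p∣m)

  coprime⇒*∣ : ∀ {a b k} → Coprime a b → a ∣ k → b ∣ k → a * b ∣ k
  coprime⇒*∣ {a} {b} a⊥b (divides s refl) b∣sa with divides t s≡tb ← coprime-divisor (Coprime.sym a⊥b) (subst (b ∣_) (*-comm s a) b∣sa)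
    = divides t (trans (cong (_* a) s≡tb) (trans (*-assoc t b a) (cong (t *_) (*-comm b a))))

  gcd-≡ˡ : ∀ {i m} → i ∣ m → gcd i m ≡ i
  gcd-≡ˡ {i} {m} i∣m = ∣-antisym (gcd[m,n]∣m i m) (gcd-greatest ∣-refl i∣m)

  gcd-*-coprime : ∀ x y h → Coprime x y → gcd (x * y) h ≡ gcd x h * gcd y h
  gcd-*-coprime x y h x⊥y = ∣-antisym g∣g₁g₂ g₁g₂∣g
    where
    g  = gcd (x * y) h
    g₁ = gcd x h
    g₂ = gcd y h
    g₁g₂∣g : g₁ * g₂ ∣ g
    g₁g₂∣g = gcd-greatest (*-pres-∣ (gcd[m,n]∣m x h) (gcd[m,n]∣m y h))
      (coprime⇒*∣ (λ (c∣g₁ , c∣g₂) → x⊥y (∣-trans c∣g₁ (gcd[m,n]∣m x h) , ∣-trans c∣g₂ (gcd[m,n]∣m y h)))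
        (gcd[m,n]∣n x h) (gcd[m,n]∣n y h))
    g∣yg₁ : g ∣ y * g₁
    g∣yg₁ = subst (g ∣_) (sym (c*gcd[m,n]≡gcd[cm,cn] y x h))
      (gcd-greatest (subst (g ∣_) (*-comm x y) (gcd[m,n]∣m (x * y) h)) (∣n⇒∣m*n y (gcd[m,n]∣n (x * y) h)))
    g∣g₁g₂ : g ∣ g₁ * g₂
    g∣g₁g₂ = subst (g ∣_) (sym (c*gcd[m,n]≡gcd[cm,cn] g₁ y h))
      (gcd-greatest (subst (g ∣_) (*-comm y g₁) g∣yg₁) (subst (g ∣_) (*-comm h g₁) (∣m⇒∣m*n g₁ (gcd[m,n]∣n (x * y) h))))

  gcd-^ : ∀ {l h} t → Prime l → 1 ≤ h → v l h ≤ t → gcd (l ^ t) h ≡ l ^ v l h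
  gcd-^ {l} {h} t pl h>0 c≤t
    with r , h≡ , l∤r ← v-decomposition (prime⇒≥2 pl) h>0 | o , refl ← m≤n⇒∃[o]m+o≡n c≤t = begin
    gcd (l ^ (c + o)) h             ≡⟨ cong₂ gcd (^-distribˡ-+-* l c o) h≡ ⟩
    gcd (l ^ c * l ^ o) (l ^ c * r) ≡⟨ sym (c*gcd[m,n]≡gcd[cm,cn] (l ^ c) (l ^ o) r) ⟩
    l ^ c * gcd (l ^ o) r           ≡⟨ cong (l ^ c *_) (coprime⇒gcd≡1 (coprime-^ o pl l∤r)) ⟩
    l ^ c * 1                       ≡⟨ *-identityʳ (l ^ c) ⟩
    l ^ c                           ∎
    where
    open ≡-Reasoning
    c = v l h

  ∣primePower⇒≡^ : ∀ {l x} a → Prime l → x ∣ l ^ a → ∃[ i ] i ≤ a × x ≡ l ^ i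
  ∣primePower⇒≡^ zero pl x∣1 = 0 , z≤n , ∣1⇒≡1 x∣1
  ∣primePower⇒≡^ {l} {x} (suc a) pl x∣lᵃ⁺¹ with l ∣? x
  ... | no l∤x with i , i≤a , x≡ ← ∣primePower⇒≡^ a pl (coprime-divisor (Coprime.sym (coprime-^ 1 pl l∤x)) (subst (x ∣_) (cong (_* l ^ a) (sym (*-identityʳ l))) x∣lᵃ⁺¹))
    = i , m≤n⇒m≤1+n i≤a , x≡
  ... | yes (divides y refl) with i , i≤a , y≡ ← ∣primePower⇒≡^ a pl (*-cancelˡ-∣ l {{>-nonZero (≤-trans (s≤s z≤n) (prime⇒≥2 pl))}} (subst (_∣ l * l ^ a) (*-comm y l) x∣lᵃ⁺¹))
    = suc i , s≤s i≤a , trans (*-comm y l) (cong (l *_) y≡)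

  primeDivisors-*-↭ : ∀ {a b} → Coprime a b → 1 ≤ a → 1 ≤ b → primeDivisors (a * b) ↭ primeDivisors a ++ primeDivisors b
  primeDivisors-*-↭ {a} {b} a⊥b a>0 b>0 = unique-sameElements⇒↭ (primeDivisors-unique (a * b))
    (Unique.++⁺ (primeDivisors-unique a) (primeDivisors-unique b) disjoint) to from
    where
    disjoint : ∀ {l} → ¬ (l ∈ primeDivisors a × l ∈ primeDivisors b)
    disjoint (l∈a , l∈b) with pl , l∣a ← ∈primeDivisors⁻ {a} l∈a = coprime⇒prime∤ a⊥b pl l∣a (proj₂ (∈primeDivisors⁻ {b} l∈b))
    to : ∀ {l} → l ∈ primeDivisors (a * b) → l ∈ primeDivisors a ++ primeDivisors b
    to l∈ with pl , l∣ab ← ∈primeDivisors⁻ {a * b} l∈ with euclidsLemma a b pl l∣ab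
    ... | inj₁ l∣a = ∈-++⁺ˡ (∈primeDivisors⁺ a>0 pl l∣a)
    ... | inj₂ l∣b = ∈-++⁺ʳ (primeDivisors a) (∈primeDivisors⁺ b>0 pl l∣b)
    from : ∀ {l} → l ∈ primeDivisors a ++ primeDivisors b → l ∈ primeDivisors (a * b)
    from l∈ with ∈-++⁻ (primeDivisors a) l∈
    ... | inj₁ l∈a = let pl , l∣a = ∈primeDivisors⁻ {a} l∈a in ∈primeDivisors⁺ (*-mono-≤ a>0 b>0) pl (∣m⇒∣m*n b l∣a)
    ... | inj₂ l∈b = let pl , l∣b = ∈primeDivisors⁻ {b} l∈b in ∈primeDivisors⁺ (*-mono-≤ a>0 b>0) pl (∣n⇒∣m*n a l∣b)

  primeDivisors-primePower-↭ : ∀ {l} a → Prime l → 1 ≤ a → primeDivisors (l ^ a) ↭ [ l ]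
  primeDivisors-primePower-↭ {l} a pl a>0 = unique-sameElements⇒↭ (primeDivisors-unique (l ^ a)) ([] ∷ []) to from
    where
    open import Data.List.Relation.Unary.AllPairs using ([]; _∷_)
    to : ∀ {p} → p ∈ primeDivisors (l ^ a) → p ∈ [ l ]
    to p∈ with pp , p∣lᵃ ← ∈primeDivisors⁻ {l ^ a} p∈ = here (prime∣primePower⇒≡ a pp pl p∣lᵃ)
    from : ∀ {p} → p ∈ [ l ] → p ∈ primeDivisors (l ^ a)
    from (here refl) = ∈primeDivisors⁺ (^>0 a (≤-trans (s≤s z≤n) (prime⇒≥2 pl))) pl
      (subst (_∣ l ^ a) (*-identityʳ l) (^-monoʳ-∣ l a>0))

module CoprimeParts where

  open import Data.Nat
  open import Data.Nat.Properties
  open import Data.Nat.Divisibility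
  open import Data.Nat.Coprimality using (Coprime)
  open import Data.Nat.Primality using (Prime; euclidsLemma)
  open import Data.Nat.ListAction using (product)
  open import Data.Nat.ListAction.Properties using (product-++; product-↭; ∈⇒∣product)
  open import Data.List using (List; []; _∷_; map; _++_; foldr)
  open import Data.List.Properties using (map-++)
  open import Data.List.Membership.Propositional using (_∈_)
  open import Data.List.Membership.Propositional.Properties using (∈-map⁺)
  open import Data.List.Relation.Unary.Any using (here; there)
  open import Data.List.Relation.Unary.AllPairs using (_∷_)
  import Data.List.Relation.Unary.All as All
  open import Data.List.Relation.Unary.Unique.Propositional using (Unique)
  open import Data.List.Relation.Binary.Permutation.Propositional.Properties using (map⁺)
  open Valuation
  open PrimeFactors

  ∏primePowers : (ℕ → ℕ) → List ℕ → ℕ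
  ∏primePowers g xs = product (map (λ l → l ^ g l) xs)

  coprimePart≡∏ : ∀ k m → coprimePart k m ≡ ∏primePowers (λ l → v l k) (primeDivisors m)
  coprimePart≡∏ k m = go (primeDivisors m)
    where
    go : ∀ xs → foldr (λ l acc → l ^ v l k * acc) 1 xs ≡ ∏primePowers (λ l → v l k) xs
    go []       = refl
    go (x ∷ xs) = cong (x ^ v x k *_) (go xs)

  prime∣∏primePowers⇒∈ : ∀ {p} g xs → Prime p → (∀ {l} → l ∈ xs → Prime l) → p ∣ ∏primePowers g xs → p ∈ xs
  prime∣∏primePowers⇒∈ g []       pp _      p∣1 = ⊥-elim (≥2⇒∤1 (prime⇒≥2 pp) p∣1)
  prime∣∏primePowers⇒∈ g (l ∷ xs) pp primes p∣ with euclidsLemma (l ^ g l) (∏primePowers g xs) pp p∣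
  ... | inj₁ p∣lᵍ = here (prime∣primePower⇒≡ (g l) pp (primes (here refl)) p∣lᵍ)
  ... | inj₂ p∣∏  = there (prime∣∏primePowers⇒∈ g xs pp (primes ∘ there) p∣∏)

  ∏primePowers∣ : ∀ {K} g xs → Unique xs → (∀ {l} → l ∈ xs → Prime l) → (∀ {l} → l ∈ xs → l ^ g l ∣ K) →
    ∏primePowers g xs ∣ K
  ∏primePowers∣ {K} g []       _          _      _   = 1∣ K
  ∏primePowers∣     g (l ∷ xs) (l∉ ∷ xs!) primes l∣K = coprime⇒*∣
    (coprime-^ (g l) (primes (here refl)) λ l∣∏ → All.lookup l∉ (prime∣∏primePowers⇒∈ g xs (primes (here refl)) (primes ∘ there) l∣∏) refl)
    (l∣K (here refl)) (∏primePowers∣ g xs xs! (primes ∘ there) (l∣K ∘ there))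

  coprimePart-* : ∀ k {a b} → Coprime a b → 1 ≤ a → 1 ≤ b → coprimePart k (a * b) ≡ coprimePart k a * coprimePart k b
  coprimePart-* k {a} {b} a⊥b a>0 b>0 = begin
    coprimePart k (a * b)                                   ≡⟨ coprimePart≡∏ k (a * b) ⟩
    product (map f (primeDivisors (a * b)))                 ≡⟨ product-↭ (map⁺ f (primeDivisors-*-↭ a⊥b a>0 b>0)) ⟩
    product (map f (primeDivisors a ++ primeDivisors b))    ≡⟨ cong product (map-++ f (primeDivisors a) (primeDivisors b)) ⟩
    product (map f (primeDivisors a) ++ map f (primeDivisors b)) ≡⟨ product-++ (map f (primeDivisors a)) _ ⟩
    product (map f (primeDivisors a)) * product (map f (primeDivisors b)) ≡⟨ sym (cong₂ _*_ (coprimePart≡∏ k a) (coprimePart≡∏ k b)) ⟩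
    coprimePart k a * coprimePart k b                       ∎
    where
    open ≡-Reasoning
    f = λ l → l ^ v l k

  coprimePart-primePower : ∀ k {l} a → Prime l → 1 ≤ a → coprimePart k (l ^ a) ≡ l ^ v l k
  coprimePart-primePower k {l} a pl a>0 = begin
    coprimePart k (l ^ a)            ≡⟨ coprimePart≡∏ k (l ^ a) ⟩
    ∏primePowers (λ p → v p k) (primeDivisors (l ^ a)) ≡⟨ product-↭ (map⁺ (λ p → p ^ v p k) (primeDivisors-primePower-↭ a pl a>0)) ⟩
    l ^ v l k * 1                    ≡⟨ *-identityʳ _ ⟩
    l ^ v l k                        ∎
    where open ≡-Reasoning

  coprimePart-prime : ∀ k {l} → Prime l → coprimePart k l ≡ l ^ v l k
  coprimePart-prime k {l} pl = trans (cong (coprimePart k) (sym (*-identityʳ l))) (coprimePart-primePower k 1 pl ≤-refl)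

  ∏primePowers>0 : ∀ g xs → (∀ {l} → l ∈ xs → Prime l) → 1 ≤ ∏primePowers g xs
  ∏primePowers>0 g []       _      = s≤s z≤n
  ∏primePowers>0 g (l ∷ xs) primes =
    *-mono-≤ (^>0 (g l) (≤-trans (s≤s z≤n) (prime⇒≥2 (primes (here refl))))) (∏primePowers>0 g xs (primes ∘ there))

  coprimePart>0 : ∀ k m → 1 ≤ coprimePart k m
  coprimePart>0 k m = subst (1 ≤_) (sym (coprimePart≡∏ k m)) (∏primePowers>0 (λ l → v l k) (primeDivisors m) (proj₁ ∘ ∈primeDivisors⁻ {m}))

  coprimePart∣ : ∀ {k m K} → 1 ≤ K → (∀ {l} → Prime l → l ∣ m → v l k ≤ v l K) → coprimePart k m ∣ K
  coprimePart∣ {k} {m} K>0 v≤v = subst (_∣ _) (sym (coprimePart≡∏ k m))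
    (∏primePowers∣ (λ l → v l k) (primeDivisors m) (primeDivisors-unique m) (proj₁ ∘ ∈primeDivisors⁻ {m})
      (λ l∈ → let pl , l∣m = ∈primeDivisors⁻ {m} l∈ in ≤v⇒^∣ (prime⇒≥2 pl) K>0 (v≤v pl l∣m)))

  coprimePart∣self : ∀ {k} m → 1 ≤ k → coprimePart k m ∣ k
  coprimePart∣self {k} m k>0 = coprimePart∣ {k} {m} k>0 (λ _ _ → ≤-refl)

  ^v∣coprimePart : ∀ {l} k {m} → Prime l → 1 ≤ m → l ∣ m → l ^ v l k ∣ coprimePart k m
  ^v∣coprimePart {l} k {m} pl m>0 l∣m = subst (_ ∣_) (sym (coprimePart≡∏ k m))
    (∈⇒∣product (∈-map⁺ (λ p → p ^ v p k) (∈primeDivisors⁺ m>0 pl l∣m)))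

  ^-pres-∣ : ∀ {a b} n → a ∣ b → a ^ n ∣ b ^ n
  ^-pres-∣ zero    _   = ∣-refl
  ^-pres-∣ (suc n) a∣b = *-pres-∣ a∣b (^-pres-∣ n a∣b)

  ∏primePowers∣^∞ : ∀ {m} g xs → (∀ {l} → l ∈ xs → l ∣ m) → ∏primePowers g xs ∣ m ^∞
  ∏primePowers∣^∞     g []       _   = 0 , ∣-refl
  ∏primePowers∣^∞ {m} g (l ∷ xs) l∣m with M , ∏∣ ← ∏primePowers∣^∞ g xs (l∣m ∘ there) =
    g l + M , subst (l ^ g l * _ ∣_) (sym (^-distribˡ-+-* m (g l) M)) (*-pres-∣ (^-pres-∣ (g l) (l∣m (here refl))) ∏∣)

  coprimePart∣^∞ : ∀ k m → coprimePart k m ∣ m ^∞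
  coprimePart∣^∞ k m with M , ∏∣ ← ∏primePowers∣^∞ (λ l → v l k) (primeDivisors m) (proj₂ ∘ ∈primeDivisors⁻ {m})
    = M , subst (_∣ m ^ M) (sym (coprimePart≡∏ k m)) ∏∣

  ∣^∞⇒>0 : ∀ {n m} → 1 ≤ m → n ∣ m ^∞ → 1 ≤ n
  ∣^∞⇒>0 {zero}  m>0 (k , 0∣mᵏ) = ⊥-elim (<⇒≢ (^>0 k m>0) (sym (0∣⇒≡0 0∣mᵏ)))
  ∣^∞⇒>0 {suc n} _   _          = s≤s z≤n

  ∣-∣^∞ : ∀ {a b m} → a ∣ b → b ∣ m ^∞ → a ∣ m ^∞
  ∣-∣^∞ a∣b (k , b∣mᵏ) = k , ∣-trans a∣b b∣mᵏ

  prime∣coprimePart⇒∣ : ∀ {p} k m → Prime p → p ∣ coprimePart k m → p ∣ m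
  prime∣coprimePart⇒∣ k m pp p∣ with M , ∣mᴹ ← coprimePart∣^∞ k m = prime∣^⇒∣ M pp (∣-trans p∣ ∣mᴹ)

module Möbius where

  open import Data.Nat
  open import Data.Nat.Properties
  open import Data.Nat.Divisibility
  open import Data.Nat.Coprimality using (Coprime; coprime-divisor)
  import Data.Nat.Coprimality as Coprime
  open import Data.Nat.Primality using (Prime)
  open import Data.Bool using (Bool; true; false; _∨_; if_then_else_)
  import Data.Bool.Properties as Bool
  open import Data.Bool.ListAction using (any; or)
  open import Data.Integer using (ℤ; +_; -_)
  import Data.Integer as ℤ
  import Data.Integer.Properties as ℤ
  open import Data.List using (List; []; _∷_; map; length; _++_)
  open import Data.List.Properties using (map-++; length-++)
  open import Data.List.Membership.Propositional using (_∈_)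
  open import Data.List.Relation.Unary.Any using (here; there)
  open import Data.List.Relation.Binary.Permutation.Propositional.Properties using (map⁺; ↭-length)
  open import Relation.Nullary.Decidable using (dec-true; dec-false; does-⇔)
  open ListFold Bool.∨-isCommutativeMonoid using (fold-++; fold-↭)
  open Valuation
  open PrimeFactors

  -- μ n unfolds to  if squareful n then + 0 else sign (ω n).
  sign : ℕ → ℤ
  sign n = if does (2 ∣? n) then + 1 else - (+ 1)

  squareful : ℕ → Bool
  squareful n = any (λ l → does (l * l ∣? n)) (primeDivisors n)

  ω : ℕ → ℕ
  ω n = length (primeDivisors n)

  sign-2+ : ∀ n → sign (2 + n) ≡ sign n
  sign-2+ n = cong (λ b → if b then + 1 else - (+ 1))
    (does-⇔ (mk⇔ (λ 2∣2+n → ∣m+n∣m⇒∣n 2∣2+n ∣-refl) (∣m∣n⇒∣m+n ∣-refl)) (2 ∣? 2 + n) (2 ∣? n))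

  sign-suc : ∀ n → sign (suc n) ≡ ℤ.- sign n
  sign-suc zero          = refl
  sign-suc (suc zero)    = refl
  sign-suc (suc (suc n)) = begin
    sign (3 + n)   ≡⟨ sign-2+ (suc n) ⟩
    sign (suc n)   ≡⟨ sign-suc n ⟩
    ℤ.- sign n     ≡⟨ cong ℤ.-_ (sym (sign-2+ n)) ⟩
    ℤ.- sign (2 + n) ∎
    where open ≡-Reasoning

  sign-+ : ∀ m n → sign (m + n) ≡ sign m ℤ.* sign n
  sign-+ zero    n = sym (ℤ.*-identityˡ (sign n))
  sign-+ (suc m) n = begin
    sign (suc (m + n))           ≡⟨ sign-suc (m + n) ⟩
    ℤ.- sign (m + n)             ≡⟨ cong ℤ.-_ (sign-+ m n) ⟩
    ℤ.- (sign m ℤ.* sign n)      ≡⟨ ℤ.neg-distribˡ-* (sign m) (sign n) ⟩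
    ℤ.- sign m ℤ.* sign n        ≡⟨ cong (ℤ._* sign n) (sym (sign-suc m)) ⟩
    sign (suc m) ℤ.* sign n      ∎
    where open ≡-Reasoning

  ω-* : ∀ {a b} → Coprime a b → 1 ≤ a → 1 ≤ b → ω (a * b) ≡ ω a + ω b
  ω-* {a} {b} a⊥b a>0 b>0 = trans (↭-length (primeDivisors-*-↭ a⊥b a>0 b>0)) (length-++ (primeDivisors a))

  any-cong : ∀ {A : Set} {P Q : A → Bool} (xs : List A) → (∀ {x} → x ∈ xs → P x ≡ Q x) → any P xs ≡ any Q xs
  any-cong []       _  = refl
  any-cong (x ∷ xs) eq = cong₂ _∨_ (eq (here refl)) (any-cong xs (eq ∘ there))

  squareTest-local : ∀ {a b l} → Coprime a b → l ∈ primeDivisors a → does (l * l ∣? a * b) ≡ does (l * l ∣? a)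
  squareTest-local {a} {b} {l} a⊥b l∈ with pl , l∣a ← ∈primeDivisors⁻ {a} l∈ =
    does-⇔ (mk⇔ (coprime-divisor l²⊥b ∘ subst (l * l ∣_) (*-comm a b)) (∣m⇒∣m*n b)) (l * l ∣? a * b) (l * l ∣? a)
    where
    l²⊥b : Coprime (l * l) b
    l²⊥b = subst (λ z → Coprime z b) (cong (l *_) (*-identityʳ l)) (coprime-^ 2 pl (coprime⇒prime∤ a⊥b pl l∣a))

  squareful-* : ∀ {a b} → Coprime a b → 1 ≤ a → 1 ≤ b → squareful (a * b) ≡ squareful a ∨ squareful b
  squareful-* {a} {b} a⊥b a>0 b>0 = begin
    any P (primeDivisors (a * b))                         ≡⟨ fold-↭ (map⁺ P (primeDivisors-*-↭ a⊥b a>0 b>0)) ⟩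
    any P (primeDivisors a ++ primeDivisors b)            ≡⟨ cong or (map-++ P (primeDivisors a) (primeDivisors b)) ⟩
    or (map P (primeDivisors a) ++ map P (primeDivisors b)) ≡⟨ fold-++ (map P (primeDivisors a)) _ ⟩
    any P (primeDivisors a) ∨ any P (primeDivisors b)     ≡⟨ cong₂ _∨_ (any-cong (primeDivisors a) (squareTest-local a⊥b))
                                                               (any-cong (primeDivisors b) (λ {l} l∈ → trans (cong (λ n → does (l * l ∣? n)) (*-comm a b)) (squareTest-local (Coprime.sym a⊥b) l∈))) ⟩
    squareful a ∨ squareful b                             ∎
    where
    open ≡-Reasoning
    P = λ l → does (l * l ∣? a * b)

  μ-* : ∀ {a b} → Coprime a b → 1 ≤ a → 1 ≤ b → μ (a * b) ≡ μ a ℤ.* μ b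
  μ-* {a} {b} a⊥b a>0 b>0 =
    trans (cong₂ (λ s n → if s then + 0 else sign n) (squareful-* a⊥b a>0 b>0) (ω-* a⊥b a>0 b>0))
          (combine (squareful a) (squareful b) (ω a) (ω b))
    where
    combine : ∀ s t m n → (if s ∨ t then + 0 else sign (m + n)) ≡ (if s then + 0 else sign m) ℤ.* (if t then + 0 else sign n)
    combine true  t     m n = refl
    combine false true  m n = sym (ℤ.*-zeroʳ (sign m))
    combine false false m n = sign-+ m n

  any-∈ : ∀ {A : Set} (P : A → Bool) {x} xs → x ∈ xs → P x ≡ true → any P xs ≡ true
  any-∈ P (y ∷ xs) (here refl) Px = cong (_∨ any P xs) Px
  any-∈ P (y ∷ xs) (there x∈)  Px = trans (cong (P y ∨_) (any-∈ P xs x∈ Px)) (Bool.∨-zeroʳ (P y))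

  μ-squareful : ∀ {l n} → Prime l → 1 ≤ n → l * l ∣ n → μ n ≡ + 0
  μ-squareful {l} {n} pl n>0 l²∣n = cong (λ s → if s then + 0 else sign (ω n))
    (any-∈ (λ p → does (p * p ∣? n)) (primeDivisors n) (∈primeDivisors⁺ n>0 pl (∣-trans (∣m⇒∣m*n l ∣-refl) l²∣n))
      (dec-true (l * l ∣? n) l²∣n))

  μ-prime : ∀ {l} → Prime l → μ l ≡ - (+ 1)
  μ-prime {l} pl = begin
    μ l                                  ≡⟨ cong μ (sym (*-identityʳ l)) ⟩
    μ (l ^ 1)                            ≡⟨ cong₂ (λ s n → if s then + 0 else sign n) not-squareful (↭-length (primeDivisors-primePower-↭ 1 pl ≤-refl)) ⟩
    sign 1                               ∎
    where
    open ≡-Reasoning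
    l>0 = ≤-trans (s≤s z≤n) (prime⇒≥2 pl)
    l²∤l : ¬ (l * l ∣ l ^ 1)
    l²∤l l²∣l = <⇒≱ (m<m*n l l {{>-nonZero l>0}} (prime⇒≥2 pl)) (subst (l * l ≤_) (*-identityʳ l) (∣⇒≤ {{>-nonZero (^>0 1 l>0)}} l²∣l))
    not-squareful : squareful (l ^ 1) ≡ false
    not-squareful = trans (fold-↭ (map⁺ (λ p → does (p * p ∣? l ^ 1)) (primeDivisors-primePower-↭ 1 pl ≤-refl)))
      (trans (Bool.∨-identityʳ _) (dec-false (l * l ∣? l ^ 1) l²∤l))

module Fractions where

  open import Data.Nat using (ℕ; zero; suc; _≤_; _^_)
  import Data.Nat as ℕ
  import Data.Nat.Properties as ℕ
  open import Data.Integer using (ℤ; +_; -1ℤ)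
  import Data.Integer as ℤ
  import Data.Integer.Properties as ℤ
  open import Data.Rational using (ℚ; 0ℚ; 1ℚ; _*_; -_; fromℚᵘ)
  import Data.Rational.Properties as ℚ
  open import Data.Rational.Unnormalised using (mkℚᵘ; *≡*)
  import Data.Rational.Unnormalised as ℚᵘ
  import Data.Rational.Unnormalised.Properties as ℚᵘ

  fromℚᵘ-* : ∀ p q → fromℚᵘ (p ℚᵘ.* q) ≡ fromℚᵘ p * fromℚᵘ q
  fromℚᵘ-* p q = ℚ.toℚᵘ-injective
    (ℚᵘ.≃-trans (ℚ.toℚᵘ-fromℚᵘ (p ℚᵘ.* q))
    (ℚᵘ.≃-trans (ℚᵘ.*-cong (ℚᵘ.≃-sym (ℚ.toℚᵘ-fromℚᵘ p)) (ℚᵘ.≃-sym (ℚ.toℚᵘ-fromℚᵘ q)))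
                 (ℚᵘ.≃-sym (ℚ.toℚᵘ-homo-* (fromℚᵘ p) (fromℚᵘ q)))))

  frac-* : ∀ a b {m n} → 1 ≤ m → 1 ≤ n → frac (a ℤ.* b) (m ℕ.* n) ≡ frac a m * frac b n
  frac-* a b {suc m} {suc n} _ _ = fromℚᵘ-* (mkℚᵘ a m) (mkℚᵘ b n)

  frac-cross : ∀ a b {m n} → 1 ≤ m → 1 ≤ n → a ℤ.* + n ≡ b ℤ.* + m → frac a m ≡ frac b n
  frac-cross a b {suc m} {suc n} _ _ an≡bm = ℚ.fromℚᵘ-cong {mkℚᵘ a m} {mkℚᵘ b n} (*≡* an≡bm)

  frac-neg : ∀ z n → frac (-1ℤ ℤ.* z) n ≡ - frac z n
  frac-neg z zero    = refl
  frac-neg z (suc n) = begin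
    frac (-1ℤ ℤ.* z) (suc n)          ≡⟨ cong (frac (-1ℤ ℤ.* z)) (sym (ℕ.*-identityˡ (suc n))) ⟩
    frac (-1ℤ ℤ.* z) (1 ℕ.* suc n)    ≡⟨ frac-* -1ℤ z {1} {suc n} (ℕ.s≤s ℕ.z≤n) (ℕ.s≤s ℕ.z≤n) ⟩
    - 1ℚ * frac z (suc n)             ≡⟨ sym (ℚ.neg-distribˡ-* 1ℚ (frac z (suc n))) ⟩
    - (1ℚ * frac z (suc n))           ≡⟨ cong -_ (ℚ.*-identityˡ (frac z (suc n))) ⟩
    - frac z (suc n)                  ∎
    where open ≡-Reasoning

  frac-^-cross : ∀ l {i j i′ j′} → 1 ≤ l → i ℕ.+ j′ ≡ i′ ℕ.+ j → frac (+ (l ^ i)) (l ^ j) ≡ frac (+ (l ^ i′)) (l ^ j′)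
  frac-^-cross l {i} {j} {i′} {j′} l>0 exponents = frac-cross _ _ (lⁿ>0 j) (lⁿ>0 j′) (begin
    + (l ^ i) ℤ.* + (l ^ j′)   ≡⟨ sym (ℤ.pos-* (l ^ i) (l ^ j′)) ⟩
    + (l ^ i ℕ.* l ^ j′)       ≡⟨ cong +_ (sym (ℕ.^-distribˡ-+-* l i j′)) ⟩
    + (l ^ (i ℕ.+ j′))         ≡⟨ cong (λ k → + (l ^ k)) exponents ⟩
    + (l ^ (i′ ℕ.+ j))         ≡⟨ cong +_ (ℕ.^-distribˡ-+-* l i′ j) ⟩
    + (l ^ i′ ℕ.* l ^ j)       ≡⟨ ℤ.pos-* (l ^ i′) (l ^ j) ⟩
    + (l ^ i′) ℤ.* + (l ^ j)   ∎)
    where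
    open ≡-Reasoning
    lⁿ>0 : ∀ n → 1 ≤ l ^ n
    lⁿ>0 n = ℕ.m^n>0 l {{ℕ.>-nonZero l>0}} n

  frac-self : ∀ {n} → 1 ≤ n → frac (+ n) n ≡ 1ℚ
  frac-self {n} n>0 = frac-cross (+ n) (+ 1) n>0 (ℕ.s≤s ℕ.z≤n) (ℤ.*-comm (+ n) (+ 1))

  frac-0 : ∀ z n → frac (+ 0 ℤ.* z) n ≡ 0ℚ
  frac-0 z zero    = refl
  frac-0 z (suc n) = ℚ.0/n≡0 (suc n)

module DivisorSums where

  open import Data.Nat using (ℕ; suc; _≤_; _<_; s≤s; z≤n; _^_)
  import Data.Nat as ℕ
  import Data.Nat.Properties as ℕ
  open import Data.Nat.Divisibility using (_∣_; divides; *-pres-∣)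
  open import Data.Nat.GCD using (gcd; gcd-comm; gcd[m,n]∣m)
  open import Data.Nat.Coprimality using (Coprime; coprime⇒gcd≡1)
  import Data.Nat.Coprimality as Coprime
  open import Data.Nat.Primality using (Prime)
  open import Data.Integer using (ℤ; +_)
  import Data.Integer as ℤ
  import Data.Integer.Properties as ℤ
  open import Data.Rational using (ℚ; 0ℚ; _+_; _*_; _-_; -_)
  import Data.Rational.Properties as ℚ
  open import Data.List using (upTo; cartesianProduct)
  open import Data.List.Membership.Propositional using (_∈_)
  open import Data.List.Membership.Propositional.Properties using (∈-cartesianProduct⁺; ∈-cartesianProduct⁻; ∈-upTo⁺; ∈-upTo⁻)
  import Data.List.Relation.Unary.Unique.Propositional.Properties as Unique
  open import Algebra.Properties.CommutativeSemigroup ℤ.*-commutativeSemigroup using () renaming (interchange to ℤ*-interchange)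
  open Sums
  open Valuation
  open PrimeFactors
  open Möbius using (μ-*; μ-prime; μ-squareful)
  open Fractions

  ∑∣-* : ∀ {m n} → Coprime m n → 1 ≤ m → 1 ≤ n → (F : ℕ → ℚ) →
    ∑[ k ∣ m ℕ.* n ] F k ≡ ∑[ i ∣ m ] ∑[ j ∣ n ] F (i ℕ.* j)
  ∑∣-* {m} {n} m⊥n m>0 n>0 F = trans
    (sym (∑-reindex (uncurry ℕ._*_) F (Unique.cartesianProduct⁺ (divisors-unique m) (divisors-unique n))
      (divisors-unique (m ℕ.* n)) injective into onto))
    (∑-cartesianProduct (divisors m) (divisors n) (λ i j → F (i ℕ.* j)))
    where
    pairs = cartesianProduct (divisors m) (divisors n)
    gcd[ij,m]≡i : ∀ {i j} → i ∣ m → j ∣ n → gcd (i ℕ.* j) m ≡ i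
    gcd[ij,m]≡i {i} {j} i∣m j∣n = begin
      gcd (i ℕ.* j) m     ≡⟨ gcd-*-coprime i j m (coprime-∣ m⊥n i∣m j∣n) ⟩
      gcd i m ℕ.* gcd j m ≡⟨ cong₂ ℕ._*_ (gcd-≡ˡ i∣m) (coprime⇒gcd≡1 (coprime-∣ (Coprime.sym m⊥n) j∣n (divides 1 (sym (ℕ.*-identityˡ m))))) ⟩
      i ℕ.* 1             ≡⟨ ℕ.*-identityʳ i ⟩
      i                   ∎
      where open ≡-Reasoning
    gcd[ij,n]≡j : ∀ {i j} → i ∣ m → j ∣ n → gcd (i ℕ.* j) n ≡ j
    gcd[ij,n]≡j {i} {j} i∣m j∣n = begin
      gcd (i ℕ.* j) n     ≡⟨ cong (λ k → gcd k n) (ℕ.*-comm i j) ⟩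
      gcd (j ℕ.* i) n     ≡⟨ gcd-*-coprime j i n (coprime-∣ (Coprime.sym m⊥n) j∣n i∣m) ⟩
      gcd j n ℕ.* gcd i n ≡⟨ cong₂ ℕ._*_ (gcd-≡ˡ j∣n) (coprime⇒gcd≡1 (coprime-∣ m⊥n i∣m (divides 1 (sym (ℕ.*-identityˡ n))))) ⟩
      j ℕ.* 1             ≡⟨ ℕ.*-identityʳ j ⟩
      j                   ∎
      where open ≡-Reasoning
    injective : ∀ {a b} → a ∈ pairs → b ∈ pairs → uncurry ℕ._*_ a ≡ uncurry ℕ._*_ b → a ≡ b
    injective {i , j} {i′ , j′} ij∈ i′j′∈ ij≡i′j′
      with i∈ , j∈ ← ∈-cartesianProduct⁻ (divisors m) (divisors n) ij∈
         | i′∈ , j′∈ ← ∈-cartesianProduct⁻ (divisors m) (divisors n) i′j′∈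
      = let i∣m = proj₁ (∈divisors⁻ {m} i∈) ; j∣n = proj₁ (∈divisors⁻ {n} j∈)
            i′∣m = proj₁ (∈divisors⁻ {m} i′∈) ; j′∣n = proj₁ (∈divisors⁻ {n} j′∈) in
        cong₂ _,_ (trans (sym (gcd[ij,m]≡i i∣m j∣n)) (trans (cong (λ k → gcd k m) ij≡i′j′) (gcd[ij,m]≡i i′∣m j′∣n)))
                  (trans (sym (gcd[ij,n]≡j i∣m j∣n)) (trans (cong (λ k → gcd k n) ij≡i′j′) (gcd[ij,n]≡j i′∣m j′∣n)))
    into : ∀ {a} → a ∈ pairs → uncurry ℕ._*_ a ∈ divisors (m ℕ.* n)
    into ij∈ with i∈ , j∈ ← ∈-cartesianProduct⁻ (divisors m) (divisors n) ij∈
      = ∈divisors⁺ (ℕ.*-mono-≤ m>0 n>0) (*-pres-∣ (proj₁ (∈divisors⁻ {m} i∈)) (proj₁ (∈divisors⁻ {n} j∈)))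
    onto : ∀ {k} → k ∈ divisors (m ℕ.* n) → ∃[ a ] a ∈ pairs × uncurry ℕ._*_ a ≡ k
    onto {k} k∈ = (gcd m k , gcd n k)
      , ∈-cartesianProduct⁺ (∈divisors⁺ m>0 (gcd[m,n]∣m m k)) (∈divisors⁺ n>0 (gcd[m,n]∣m n k))
      , trans (sym (gcd-*-coprime m n k m⊥n)) (trans (gcd-comm (m ℕ.* n) k) (gcd-≡ˡ (proj₁ (∈divisors⁻ {m ℕ.* n} k∈))))

  ∑∣-primePower : ∀ {l} a → Prime l → (F : ℕ → ℚ) → ∑[ u ∣ l ^ a ] F u ≡ ∑[ i < suc a ] F (l ^ i)
  ∑∣-primePower {l} a pl F = trans
    (sym (∑-reindex (l ^_) F (Unique.upTo⁺ (suc a)) (divisors-unique (l ^ a)) injective into onto))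
    (∑-applyUpTo id (suc a) (F ∘ (l ^_)))
    where
    l≥2 = prime⇒≥2 pl
    injective : ∀ {i j} → i ∈ upTo (suc a) → j ∈ upTo (suc a) → l ^ i ≡ l ^ j → i ≡ j
    injective {i} {j} _ _ lⁱ≡lʲ = trans (sym (v-^ i l≥2)) (trans (cong (v l) lⁱ≡lʲ) (v-^ j l≥2))
    into : ∀ {i} → i ∈ upTo (suc a) → l ^ i ∈ divisors (l ^ a)
    into i∈ = ∈divisors⁺ (^>0 a (ℕ.≤-trans (s≤s z≤n) l≥2)) (^-monoʳ-∣ l (ℕ.≤-pred (∈-upTo⁻ i∈)))
    onto : ∀ {x} → x ∈ divisors (l ^ a) → ∃[ i ] i ∈ upTo (suc a) × l ^ i ≡ x
    onto x∈ with i , i≤a , x≡ ← ∣primePower⇒≡^ a pl (proj₁ (∈divisors⁻ {l ^ a} x∈)) = i , ∈-upTo⁺ (s≤s i≤a) , sym x≡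

  ∑∣-μ-primePower : ∀ (N D : ℕ → ℕ) {l} a → Prime l → 1 ≤ a →
    ∑[ u ∣ l ^ a ] frac (μ u ℤ.* + N u) (D u) ≡ frac (+ N 1) (D 1) - frac (+ N l) (D l)
  ∑∣-μ-primePower N D {l} (suc a) pl _ = begin
    ∑[ u ∣ l ^ suc a ] T u                                ≡⟨ ∑∣-primePower (suc a) pl T ⟩
    T 1 + (T (l ^ 1) + ∑[ i < a ] T (l ^ (2 ℕ.+ i)))      ≡⟨ cong₂ _+_ T1 (cong₂ _+_ Tl (∑<-cong a (λ i _ → T-squareful i))) ⟩
    frac (+ N 1) (D 1) + (- frac (+ N l) (D l) + ∑[ i < a ] 0ℚ) ≡⟨ cong (λ x → frac (+ N 1) (D 1) + (- frac (+ N l) (D l) + x)) (∑<-0 a) ⟩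
    frac (+ N 1) (D 1) + (- frac (+ N l) (D l) + 0ℚ)      ≡⟨ cong (_+_ (frac (+ N 1) (D 1))) (ℚ.+-identityʳ (- frac (+ N l) (D l))) ⟩
    frac (+ N 1) (D 1) - frac (+ N l) (D l)               ∎
    where
    open ≡-Reasoning
    T = λ u → frac (μ u ℤ.* + N u) (D u)
    l>0 = ℕ.≤-trans (s≤s z≤n) (prime⇒≥2 pl)
    T1 : T 1 ≡ frac (+ N 1) (D 1)
    T1 = cong (λ z → frac z (D 1)) (ℤ.*-identityˡ (+ N 1))
    Tl : T (l ^ 1) ≡ - frac (+ N l) (D l)
    Tl = trans (cong T (ℕ.*-identityʳ l)) (trans (cong (λ z → frac (z ℤ.* + N l) (D l)) (μ-prime pl)) (frac-neg (+ N l) (D l)))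
    T-squareful : ∀ i → T (l ^ (2 ℕ.+ i)) ≡ 0ℚ
    T-squareful i = trans (cong (λ z → frac (z ℤ.* + N (l ^ (2 ℕ.+ i))) (D (l ^ (2 ℕ.+ i))))
        (μ-squareful pl (^>0 (2 ℕ.+ i) l>0) (divides (l ^ i) (trans (sym (ℕ.*-assoc l l (l ^ i))) (ℕ.*-comm (l ℕ.* l) (l ^ i))))))
      (frac-0 (+ N (l ^ (2 ℕ.+ i))) (D (l ^ (2 ℕ.+ i))))

module Multiplicativity where

  open import Data.Nat using (ℕ; zero; suc; _≤_; _<_; s≤s; z≤n; _^_)
  import Data.Nat as ℕ
  import Data.Nat.Properties as ℕ
  open import Data.Nat.Divisibility using (_∣_; divides; ∣-trans)
  open import Data.Nat.Coprimality using (Coprime)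
  open import Data.Nat.Primality using (Prime)
  open import Data.Nat.Induction using (<-rec)
  open import Data.List.Membership.Propositional using (_∈_)
  open import Data.Integer using (+_)
  import Data.Integer as ℤ
  import Data.Integer.Properties as ℤ
  open import Data.Rational using (ℚ; 0ℚ; _*_)
  import Data.Rational.Properties as ℚ
  open import Algebra.Properties.CommutativeSemigroup ℤ.*-commutativeSemigroup using () renaming (interchange to ℤ*-interchange)
  open import Algebra.Properties.CommutativeSemigroup ℕ.*-commutativeSemigroup using () renaming (interchange to ℕ*-interchange)
  open Sums
  open Valuation
  open PrimeFactors
  open Möbius using (μ-*)
  open Fractions
  open DivisorSums

  Multiplicative : {A : Set} → (A → A → A) → (ℕ → A) → Set
  Multiplicative _·_ G = ∀ {a b} → Coprime a b → 1 ≤ a → 1 ≤ b → G (a ℕ.* b) ≡ G a · G b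

  id-multiplicative : Multiplicative ℕ._*_ id
  id-multiplicative _ _ _ = refl

  *-multiplicative : ∀ {f g : ℕ → ℕ} → Multiplicative ℕ._*_ f → Multiplicative ℕ._*_ g →
    Multiplicative ℕ._*_ (λ u → f u ℕ.* g u)
  *-multiplicative {f} {g} f-* g-* {a} {b} a⊥b a>0 b>0 =
    trans (cong₂ ℕ._*_ (f-* a⊥b a>0 b>0) (g-* a⊥b a>0 b>0)) (ℕ*-interchange (f a) (f b) (g a) (g b))

  μ-frac-multiplicative : ∀ {N D : ℕ → ℕ} → Multiplicative ℕ._*_ N → Multiplicative ℕ._*_ D → (∀ {u} → 1 ≤ u → 1 ≤ D u) →
    Multiplicative _*_ (λ u → frac (μ u ℤ.* + N u) (D u))
  μ-frac-multiplicative {N} {D} N-* D-* D>0 {a} {b} a⊥b a>0 b>0 = begin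
    frac (μ (a ℕ.* b) ℤ.* + N (a ℕ.* b)) (D (a ℕ.* b))
      ≡⟨ cong₂ (λ z n → frac z n) numerator (D-* a⊥b a>0 b>0) ⟩
    frac ((μ a ℤ.* + N a) ℤ.* (μ b ℤ.* + N b)) (D a ℕ.* D b)
      ≡⟨ frac-* _ _ (D>0 a>0) (D>0 b>0) ⟩
    frac (μ a ℤ.* + N a) (D a) * frac (μ b ℤ.* + N b) (D b) ∎
    where
    open ≡-Reasoning
    numerator : μ (a ℕ.* b) ℤ.* + N (a ℕ.* b) ≡ (μ a ℤ.* + N a) ℤ.* (μ b ℤ.* + N b)
    numerator = begin
      μ (a ℕ.* b) ℤ.* + N (a ℕ.* b)       ≡⟨ cong₂ (λ m n → m ℤ.* + n) (μ-* a⊥b a>0 b>0) (N-* a⊥b a>0 b>0) ⟩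
      (μ a ℤ.* μ b) ℤ.* + (N a ℕ.* N b)   ≡⟨ cong (μ a ℤ.* μ b ℤ.*_) (ℤ.pos-* (N a) (N b)) ⟩
      (μ a ℤ.* μ b) ℤ.* (+ N a ℤ.* + N b) ≡⟨ ℤ*-interchange (μ a) (μ b) (+ N a) (+ N b) ⟩
      (μ a ℤ.* + N a) ℤ.* (μ b ℤ.* + N b) ∎

  ∑∣-multiplicative : ∀ {R : ℕ → ℚ} → Multiplicative _*_ R → Multiplicative _*_ (λ n → ∑[ u ∣ n ] R u)
  ∑∣-multiplicative {R} R-* {a} {b} a⊥b a>0 b>0 = begin
    ∑[ u ∣ a ℕ.* b ] R u                 ≡⟨ ∑∣-* a⊥b a>0 b>0 R ⟩
    ∑[ i ∣ a ] ∑[ j ∣ b ] R (i ℕ.* j)    ≡⟨ ∑-cong (divisors a) (λ i∈ → ∑-cong (divisors b) (λ j∈ → R-*-divisors i∈ j∈)) ⟩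
    ∑[ i ∣ a ] ∑[ j ∣ b ] (R i * R j)    ≡⟨ sym (∑-*-∑ (divisors a) (divisors b) R R) ⟩
    (∑[ i ∣ a ] R i) * (∑[ j ∣ b ] R j)  ∎
    where
    open ≡-Reasoning
    R-*-divisors : ∀ {i j} → i ∈ divisors a → j ∈ divisors b → R (i ℕ.* j) ≡ R i * R j
    R-*-divisors i∈ j∈ with i∣a , i>0 ← ∈divisors⁻ {a} i∈ | j∣b , j>0 ← ∈divisors⁻ {b} j∈ = R-* (coprime-∣ a⊥b i∣a j∣b) i>0 j>0

  primePower-split : ∀ {l n} → Prime l → 1 ≤ n → l ∣ n →
    ∃[ r ] n ≡ l ^ v l n ℕ.* r × Coprime (l ^ v l n) r × 1 ≤ v l n × 1 ≤ r × ¬ (l ∣ r)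
  primePower-split {l} {n} pl n>0 l∣n with r , n≡ , l∤r ← v-decomposition (prime⇒≥2 pl) n>0 =
    r , n≡ , coprime-^ (v l n) pl l∤r , ∣⇒v≥1 (prime⇒≥2 pl) n>0 l∣n , ∤⇒>0 l∤r , l∤r

  multiplicative-zero : ∀ {G : ℕ → ℚ} {l n} → Multiplicative _*_ G → 1 ≤ n → Prime l → l ∣ n →
    G (l ^ v l n) ≡ 0ℚ → G n ≡ 0ℚ
  multiplicative-zero {G} {l} {n} G-* n>0 pl l∣n Glᵃ≡0 with r , n≡ , lᵃ⊥r , a>0 , r>0 , _ ← primePower-split pl n>0 l∣n = begin
    G n                        ≡⟨ cong G n≡ ⟩
    G (l ^ v l n ℕ.* r)        ≡⟨ G-* lᵃ⊥r (^>0 (v l n) (ℕ.≤-trans (s≤s z≤n) (prime⇒≥2 pl))) r>0 ⟩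
    G (l ^ v l n) * G r        ≡⟨ cong (_* G r) Glᵃ≡0 ⟩
    0ℚ * G r                   ≡⟨ ℚ.*-zeroˡ (G r) ⟩
    0ℚ                         ∎
    where open ≡-Reasoning

  multiplicative-≡ : ∀ {G H : ℕ → ℚ} → Multiplicative _*_ G → Multiplicative _*_ H → G 1 ≡ H 1 →
    ∀ {n} → 1 ≤ n → (∀ {l} → Prime l → l ∣ n → G (l ^ v l n) ≡ H (l ^ v l n)) → G n ≡ H n
  multiplicative-≡ {G} {H} G-* H-* G1≡H1 {n} = <-rec P step n
    where
    P : ℕ → Set
    P n = 1 ≤ n → (∀ {l} → Prime l → l ∣ n → G (l ^ v l n) ≡ H (l ^ v l n)) → G n ≡ H n
    step : ∀ n → (∀ {m} → m < n → P m) → P n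
    step (suc zero)          _   _   _    = G1≡H1
    step n@(suc (suc n-2)) rec n>0 agree
      with l , pl , l∣n ← ∃primeFactor n (s≤s (s≤s z≤n))
      with r , n≡ , lᵃ⊥r , a>0 , r>0 , l∤r ← primePower-split pl n>0 l∣n = begin
      G n                        ≡⟨ cong G n≡ ⟩
      G (lᵃ ℕ.* r)               ≡⟨ G-* lᵃ⊥r lᵃ>0 r>0 ⟩
      G lᵃ * G r                 ≡⟨ cong₂ _*_ (agree pl l∣n) (rec r<n r>0 agree-r) ⟩
      H lᵃ * H r                 ≡⟨ sym (H-* lᵃ⊥r lᵃ>0 r>0) ⟩
      H (lᵃ ℕ.* r)               ≡⟨ cong H (sym n≡) ⟩
      H n                        ∎
      where
      open ≡-Reasoning
      lᵃ = l ^ v l n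
      l≥2 = prime⇒≥2 pl
      lᵃ>0 = ^>0 (v l n) (ℕ.≤-trans (s≤s z≤n) l≥2)
      r<n : r < n
      r<n = subst (r <_) (trans (ℕ.*-comm r lᵃ) (sym n≡)) (ℕ.m<m*n r lᵃ {{ℕ.>-nonZero r>0}} (primePower≥2 pl a>0))
      v-n≡v-r : ∀ {p} → Prime p → p ∣ r → v p n ≡ v p r
      v-n≡v-r {p} pp p∣r = begin
        v p n                  ≡⟨ cong (v p) n≡ ⟩
        v p (lᵃ ℕ.* r)         ≡⟨ v-* lᵃ r pp lᵃ>0 r>0 ⟩
        v p lᵃ ℕ.+ v p r       ≡⟨ cong (ℕ._+ v p r) (v≡0 (prime⇒≥2 pp) (λ p∣lᵃ → l∤r (subst (_∣ r) (prime∣primePower⇒≡ (v l n) pp pl p∣lᵃ) p∣r))) ⟩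
        v p r                  ∎
      agree-r : ∀ {p} → Prime p → p ∣ r → G (p ^ v p r) ≡ H (p ^ v p r)
      agree-r {p} pp p∣r = subst (λ k → G (p ^ k) ≡ H (p ^ k)) (v-n≡v-r pp p∣r)
        (agree pp (∣-trans p∣r (divides lᵃ n≡)))

module Powers where

  open import Data.Nat
  open import Data.Nat.Properties
  open import Data.Nat.Divisibility
  open import Data.Nat.DivMod using (_/_; _%_; m≡m%n+[m/n]*n; m%n<n; m*[n/m]≡n)
  open import Data.Nat.Tactic.RingSolver using (solve-∀)
  open Valuation

  div-exact : ∀ {m n} → 1 ≤ n → n ∣ m → n * (m div n) ≡ m
  div-exact {m} {suc n} _ n∣m = m*[n/m]≡n n∣m

  geom : ℕ → ℕ → ℕ
  geom x zero    = 0
  geom x (suc n) = 1 + x * geom x n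

  [1+y]^n∸1≡y*geom : ∀ y n → suc y ^ n ∸ 1 ≡ y * geom (suc y) n
  [1+y]^n∸1≡y*geom y n = cong (_∸ 1) (go n)
    where
    expand : ∀ y g → suc y * (1 + y * g) ≡ 1 + y * (1 + suc y * g)
    expand = solve-∀
    go : ∀ n → suc y ^ n ≡ 1 + y * geom (suc y) n
    go zero    = cong suc (sym (*-zeroʳ y))
    go (suc n) = trans (cong (suc y *_) (go n)) (expand y (geom (suc y) n))

  ∣x∸1⇒∣x^n∸1 : ∀ {m x} n → m ∣ x ∸ 1 → m ∣ x ^ n ∸ 1
  ∣x∸1⇒∣x^n∸1 {m} {zero}  zero    _     = m ∣0
  ∣x∸1⇒∣x^n∸1 {m} {zero}  (suc n) _     = m ∣0
  ∣x∸1⇒∣x^n∸1 {m} {suc y} n       m∣y   = subst (m ∣_) (sym ([1+y]^n∸1≡y*geom y n)) (∣m⇒∣m*n (geom (suc y) n) m∣y)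

  ∣a∸1∧∣ba∸1⇒∣b∸1 : ∀ {m a b} → 1 ≤ a → 1 ≤ b → m ∣ a ∸ 1 → m ∣ b * a ∸ 1 → m ∣ b ∸ 1
  ∣a∸1∧∣ba∸1⇒∣b∸1 {m} {suc a} {suc b} _ _ m∣a m∣ba = ∣m+n∣m⇒∣n (subst (m ∣_) ba∸1≡ m∣ba) (∣n⇒∣m*n (suc b) m∣a)
    where
    ba∸1≡ : suc b * suc a ∸ 1 ≡ suc b * a + b
    ba∸1≡ = trans (cong (_∸ 1) (*-suc (suc b) a)) (+-comm b (suc b * a))

  ord∣ : ∀ {m q o N} → IsOrd m q o → 1 ≤ q → m ∣ q ^ N ∸ 1 → o ∣ N
  ord∣ {m} {q} {o} {N} (o>0 , m∣qᵒ∸1 , minimal) q>0 m∣qᴺ∸1 = by-remainder (N % o) refl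
    where
    instance _ = >-nonZero o>0
    s = N / o
    qᴺ≡ : q ^ N ≡ q ^ (N % o) * (q ^ o) ^ s
    qᴺ≡ = begin
      q ^ N                      ≡⟨ cong (q ^_) (m≡m%n+[m/n]*n N o) ⟩
      q ^ (N % o + s * o)        ≡⟨ ^-distribˡ-+-* q (N % o) (s * o) ⟩
      q ^ (N % o) * q ^ (s * o)  ≡⟨ cong (λ k → q ^ (N % o) * q ^ k) (*-comm s o) ⟩
      q ^ (N % o) * q ^ (o * s)  ≡⟨ cong (q ^ (N % o) *_) (sym (^-*-assoc q o s)) ⟩
      q ^ (N % o) * (q ^ o) ^ s  ∎
      where open ≡-Reasoning
    by-remainder : ∀ r → N % o ≡ r → o ∣ N
    by-remainder zero    N%o≡0 = divides s (trans (m≡m%n+[m/n]*n N o) (cong (_+ s * o) N%o≡0))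
    by-remainder (suc _) N%o≡r = ⊥-elim (minimal (N % o) (subst (1 ≤_) (sym N%o≡r) (s≤s z≤n)) (m%n<n N o)
      (∣a∸1∧∣ba∸1⇒∣b∸1 (^>0 s (^>0 o q>0)) (^>0 (N % o) q>0) (∣x∸1⇒∣x^n∸1 s m∣qᵒ∸1) (subst (λ k → m ∣ k ∸ 1) qᴺ≡ m∣qᴺ∸1)))

  ord∣⇒∣ : ∀ {m q o N} → IsOrd m q o → o ∣ N → m ∣ q ^ N ∸ 1
  ord∣⇒∣ {m} {q} {o} (_ , m∣qᵒ∸1 , _) (divides t refl) =
    subst (λ k → m ∣ k ∸ 1) (trans (^-*-assoc q o t) (cong (q ^_) (*-comm o t))) (∣x∸1⇒∣x^n∸1 t m∣qᵒ∸1)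

module LiftingTheExponent where

  open import Data.Nat
  open import Data.Nat.Properties
  open import Data.Nat.Divisibility
  open import Data.Nat.DivMod using (_/_; _%_; m≡m%n+[m/n]*n; m%n<n)
  open import Data.Nat.Primality using (Prime; prime[2]; prime⇒irreducible)
  open import Data.Nat.Induction using (<-rec)
  open import Data.Nat.Tactic.RingSolver using (solve-∀)
  open Valuation
  open Powers

  triangle : ℕ → ℕ
  triangle zero    = 0
  triangle (suc n) = triangle n + n

  triangle-odd : ∀ m → triangle (1 + m * 2) ≡ (1 + m * 2) * m
  triangle-odd zero    = refl
  triangle-odd (suc m) = trans (cong (λ t → t + (1 + m * 2) + (2 + m * 2)) (triangle-odd m)) (step m)
    where
    step : ∀ m → (1 + m * 2) * m + (1 + m * 2) + (2 + m * 2) ≡ (3 + m * 2) * suc m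
    step = solve-∀

  geom≡n+l* : ∀ s l n → ∃[ t ] geom (1 + s * l) n ≡ n + l * t
  geom≡n+l* s l zero    = 0 , sym (*-zeroʳ l)
  geom≡n+l* s l (suc n) with t , eq ← geom≡n+l* s l n =
    t + s * n + s * l * t , trans (cong (λ g → 1 + (1 + s * l) * g) eq) (expand s l n t)
    where
    expand : ∀ s l n t → 1 + (1 + s * l) * (n + l * t) ≡ suc n + l * (t + s * n + s * l * t)
    expand = solve-∀

  -- (1 + y)ⁱ ≡ 1 + i y modulo y², summed over i < n.
  geom-expansion : ∀ y n → ∃[ A ] geom (suc y) n ≡ n + y * triangle n + y * y * A
  geom-expansion y zero    = 0 , sym (cong₂ _+_ (*-zeroʳ y) (*-zeroʳ (y * y)))
  geom-expansion y (suc n) with A , eq ← geom-expansion y n =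
    A + triangle n + y * A , trans (cong (λ g → 1 + suc y * g) eq) (expand y n (triangle n) A)
    where
    expand : ∀ y n t A → 1 + (1 + y) * (n + y * t + y * y * A) ≡ suc n + y * (t + n) + y * y * (A + t + y * A)
    expand = solve-∀

  ≥2⇒∤1+l* : ∀ {l} k → 2 ≤ l → ¬ (l ∣ 1 + l * k)
  ≥2⇒∤1+l* {l} k l≥2 l∣ = ≥2⇒∤1 l≥2 (∣m+n∣m⇒∣n (subst (l ∣_) (+-comm 1 (l * k)) l∣) (∣m⇒∣m*n k ∣-refl))

  l∤n⇒l∤geom : ∀ {l y} n → l ∣ y → ¬ (l ∣ n) → ¬ (l ∣ geom (suc y) n)
  l∤n⇒l∤geom {l} n (divides s refl) l∤n l∣geom with t , eq ← geom≡n+l* s l n =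
    l∤n (∣m+n∣m⇒∣n (subst (l ∣_) (trans eq (+-comm n (l * t))) l∣geom) (∣m⇒∣m*n t ∣-refl))

  -- With y = s l and triangle l = l m the expansion of geom (1 + y) l is l modulo l².
  v-geom-l-odd : ∀ {l} m s → l ≡ 1 + m * 2 → 2 ≤ l → v l (geom (suc (s * l)) l) ≡ 1
  v-geom-l-odd {l} m s l≡ l≥2 with A , eq ← geom-expansion (s * l) l =
    v-unique 1 l≥2 (trans eq factor) (≥2⇒∤1+l* (s * m + s * s * A) l≥2)
    where
    factor : l + s * l * triangle l + s * l * (s * l) * A ≡ l ^ 1 * (1 + l * (s * m + s * s * A))
    factor = begin
      l + s * l * triangle l + s * l * (s * l) * A   ≡⟨ cong (λ t → l + s * l * t + s * l * (s * l) * A) (trans (cong triangle l≡) (trans (triangle-odd m) (cong (_* m) (sym l≡)))) ⟩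
      l + s * l * (l * m) + s * l * (s * l) * A      ≡⟨ regroup l s m A ⟩
      l ^ 1 * (1 + l * (s * m + s * s * A))          ∎
      where
      open ≡-Reasoning
      regroup : ∀ l s m A → l + s * l * (l * m) + s * l * (s * l) * A ≡ l * 1 * (1 + l * (s * m + s * s * A))
      regroup = solve-∀

  v₂-geom-2 : ∀ s → v 2 (geom (suc (s * 4)) 2) ≡ 1
  v₂-geom-2 s = v-unique {2} 1 (s≤s (s≤s z≤n)) (factor s) (≥2⇒∤1+l* s (s≤s (s≤s z≤n)))
    where
    factor : ∀ s → 1 + (1 + s * 4) * (1 + (1 + s * 4) * 0) ≡ 2 * 1 * (1 + 2 * s)
    factor = solve-∀

  odd⇒≡1+2* : ∀ {l} → ¬ (2 ∣ l) → ∃[ m ] l ≡ 1 + m * 2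
  odd⇒≡1+2* {l} 2∤l = l / 2 , trans (m≡m%n+[m/n]*n l 2) (cong (_+ (l / 2) * 2) l%2≡1)
    where
    l%2≡1 : l % 2 ≡ 1
    l%2≡1 with l % 2 | m%n<n l 2 | m%n≡0⇒n∣m l 2
    ... | zero          | _             | 2∣l = ⊥-elim (2∤l (2∣l refl))
    ... | suc zero      | _             | _   = refl
    ... | suc (suc _)   | s≤s (s≤s ()) | _

  geom>0 : ∀ {x} n → 1 ≤ n → 1 ≤ geom x n
  geom>0 (suc n) _ = s≤s z≤n

  v-geom-l : ∀ {l y} → Prime l → l ∣ y → (¬ (2 ∣ l) ⊎ 4 ∣ y) → v l (geom (suc y) l) ≡ 1
  v-geom-l {l} pl l∣y odd-or-4∣y with 2 ∣? l
  ... | no 2∤l with m , l≡ ← odd⇒≡1+2* 2∤l | divides s refl ← l∣y = v-geom-l-odd m s l≡ (prime⇒≥2 pl)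
  ... | yes 2∣l with odd-or-4∣y | prime⇒irreducible pl 2∣l
  ...   | inj₁ 2∤l              | _         = ⊥-elim (2∤l 2∣l)
  ...   | inj₂ (divides s refl) | inj₂ refl = v₂-geom-2 s

  v-[x^n∸1]-l∤n : ∀ {l y} n → Prime l → 1 ≤ y → 1 ≤ n → l ∣ y → ¬ (l ∣ n) → v l (suc y ^ n ∸ 1) ≡ v l y
  v-[x^n∸1]-l∤n {l} {y} n pl y>0 n>0 l∣y l∤n = begin
    v l (suc y ^ n ∸ 1)                          ≡⟨ cong (v l) ([1+y]^n∸1≡y*geom y n) ⟩
    v l (y * geom (suc y) n)                     ≡⟨ v-* y (geom (suc y) n) pl y>0 (geom>0 n n>0) ⟩
    v l y + v l (geom (suc y) n)                 ≡⟨ cong (v l y +_) (v≡0 (prime⇒≥2 pl) (l∤n⇒l∤geom n l∣y l∤n)) ⟩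
    v l y + 0                                    ≡⟨ +-identityʳ (v l y) ⟩
    v l y                                        ∎
    where open ≡-Reasoning

  v-[x^l∸1] : ∀ {l y} → Prime l → 1 ≤ y → l ∣ y → (¬ (2 ∣ l) ⊎ 4 ∣ y) → v l (suc y ^ l ∸ 1) ≡ v l y + 1
  v-[x^l∸1] {l} {y} pl y>0 l∣y odd-or-4∣y = begin
    v l (suc y ^ l ∸ 1)              ≡⟨ cong (v l) ([1+y]^n∸1≡y*geom y l) ⟩
    v l (y * geom (suc y) l)         ≡⟨ v-* y (geom (suc y) l) pl y>0 (geom>0 l (≤-trans (s≤s z≤n) (prime⇒≥2 pl))) ⟩
    v l y + v l (geom (suc y) l)     ≡⟨ cong (v l y +_) (v-geom-l pl l∣y odd-or-4∣y) ⟩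
    v l y + 1                        ∎
    where open ≡-Reasoning

  lte : ∀ {l} → Prime l → ∀ n {x} → 1 ≤ n → 2 ≤ x → l ∣ x ∸ 1 → (¬ (2 ∣ l) ⊎ 4 ∣ x ∸ 1) →
    v l (x ^ n ∸ 1) ≡ v l (x ∸ 1) + v l n
  lte {l} pl = <-rec P step
    where
    l≥2 = prime⇒≥2 pl
    P : ℕ → Set
    P n = ∀ {x} → 1 ≤ n → 2 ≤ x → l ∣ x ∸ 1 → (¬ (2 ∣ l) ⊎ 4 ∣ x ∸ 1) → v l (x ^ n ∸ 1) ≡ v l (x ∸ 1) + v l n
    step : ∀ n → (∀ {m} → m < n → P m) → P n
    step n rec {suc y} n>0 (s≤s y>0) l∣y odd-or-4∣y with l ∣? n
    ... | no l∤n = begin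
      v l (suc y ^ n ∸ 1)   ≡⟨ v-[x^n∸1]-l∤n n pl y>0 n>0 l∣y l∤n ⟩
      v l y                 ≡⟨ sym (+-identityʳ (v l y)) ⟩
      v l y + 0             ≡⟨ cong (v l y +_) (sym (v≡0 l≥2 l∤n)) ⟩
      v l y + v l n         ∎
      where open ≡-Reasoning
    ... | yes (divides m refl) = begin
      v l (x ^ (m * l) ∸ 1)     ≡⟨ cong (λ z → v l (z ∸ 1)) (trans (cong (x ^_) (*-comm m l)) (sym (^-*-assoc x l m))) ⟩
      v l ((x ^ l) ^ m ∸ 1)     ≡⟨ rec m<n m>0 xˡ≥2 (∣x∸1⇒∣x^n∸1 l l∣y) (Sum.map₂ (∣x∸1⇒∣x^n∸1 l) odd-or-4∣y) ⟩
      v l (x ^ l ∸ 1) + v l m   ≡⟨ cong (_+ v l m) (v-[x^l∸1] pl y>0 l∣y odd-or-4∣y) ⟩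
      v l y + 1 + v l m         ≡⟨ trans (+-assoc (v l y) 1 (v l m)) (cong (v l y +_) (+-comm 1 (v l m))) ⟩
      v l y + (v l m + 1)       ≡⟨ cong (v l y +_) (sym (trans (v-* m l pl m>0 (≤-trans (s≤s z≤n) l≥2)) (cong (v l m +_) (v-self l≥2)))) ⟩
      v l y + v l (m * l)       ∎
      where
      open ≡-Reasoning
      x = suc y
      m>0 : 1 ≤ m
      m>0 = n≢0⇒n>0 λ { refl → <⇒≱ n>0 z≤n }
      m<n : m < m * l
      m<n = m<m*n m l {{>-nonZero m>0}} l≥2
      xˡ≥2 : 2 ≤ x ^ l
      xˡ≥2 = ≤-trans (s≤s y>0) (m≤m^n l (s≤s z≤n) (≤-trans (s≤s z≤n) l≥2))

  2∣x∸1⇒4∣x²∸1 : ∀ {x} → 2 ∣ x ∸ 1 → 4 ∣ x ^ 2 ∸ 1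
  2∣x∸1⇒4∣x²∸1 {zero}  _                     = 4 ∣0
  2∣x∸1⇒4∣x²∸1 {suc y} (divides a y≡a*2) = divides (a * (a + 1)) (begin
    suc y ^ 2 ∸ 1                  ≡⟨ [1+y]^n∸1≡y*geom y 2 ⟩
    y * (1 + suc y * (1 + suc y * 0)) ≡⟨ cong (λ y → y * (1 + suc y * (1 + suc y * 0))) y≡a*2 ⟩
    a * 2 * (1 + suc (a * 2) * (1 + suc (a * 2) * 0)) ≡⟨ regroup a ⟩
    a * (a + 1) * 4                ∎)
    where
    open ≡-Reasoning
    regroup : ∀ a → a * 2 * (1 + suc (a * 2) * (1 + suc (a * 2) * 0)) ≡ a * (a + 1) * 4
    regroup = solve-∀

  v₂-lte-even : ∀ k {x} → 1 ≤ k → 2 ≤ x → 2 ∣ x ∸ 1 → v 2 (x ^ (k * 2) ∸ 1) ≡ v 2 (x ∸ 1) + v 2 (x + 1) + v 2 k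
  v₂-lte-even k {suc y} k>0 (s≤s y>0) 2∣y = begin
    v 2 (x ^ (k * 2) ∸ 1)          ≡⟨ cong (λ z → v 2 (z ∸ 1)) (trans (cong (x ^_) (*-comm k 2)) (sym (^-*-assoc x 2 k))) ⟩
    v 2 ((x ^ 2) ^ k ∸ 1)          ≡⟨ lte prime[2] k k>0 x²≥2 (∣-trans (divides 2 refl) 4∣x²∸1) (inj₂ 4∣x²∸1) ⟩
    v 2 (x ^ 2 ∸ 1) + v 2 k        ≡⟨ cong (λ z → v 2 z + v 2 k) x²∸1≡ ⟩
    v 2 (y * (x + 1)) + v 2 k      ≡⟨ cong (_+ v 2 k) (v-* y (x + 1) prime[2] y>0 (subst (1 ≤_) (+-comm 1 x) (s≤s z≤n))) ⟩
    v 2 y + v 2 (x + 1) + v 2 k    ∎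
    where
    open ≡-Reasoning
    x = suc y
    4∣x²∸1 = 2∣x∸1⇒4∣x²∸1 {x} 2∣y
    x²∸1≡ : x ^ 2 ∸ 1 ≡ y * (x + 1)
    x²∸1≡ = trans ([1+y]^n∸1≡y*geom y 2) (cong (y *_) (geom-2 x))
      where
      geom-2 : ∀ x → 1 + x * (1 + x * 0) ≡ x + 1
      geom-2 = solve-∀
    x²≥2 : 2 ≤ x ^ 2
    x²≥2 = ≤-trans (s≤s y>0) (m≤m^n 2 (s≤s z≤n) (s≤s z≤n))

module Eta where

  open import Data.Nat
  open import Data.Nat.Properties
  open import Data.Nat.Divisibility
  open import Data.Nat.DivMod using (_/_; _%_; m≡m%n+[m/n]*n; m%n<n)
  open import Data.Nat.GCD using (gcd; gcd[m,n]∣m; gcd[m,n]∣n; gcd-greatest; gcd-zeroʳ)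
  open import Data.Nat.Primality using (Prime; prime[2]; euclidsLemma; prime⇒irreducible)
  open import Data.Nat.Tactic.RingSolver using (solve-∀)
  open import Data.Bool using (Bool; true; false; _∧_; _∨_; not; if_then_else_)
  open import Relation.Nullary.Decidable using (dec-true; dec-false; does-⇔; _⊎-dec_; _×-dec_)
  open Valuation
  open Powers
  open Multiplicativity using (Multiplicative)
  open LiftingTheExponent

  -- 4 ∤ q^f̄ − 1 rules out 4 ∣ d, q ≡ 1 (mod 4) and f even.
  𝒫-holds : ∀ {q d f fbar} → 1 ≤ q → 2 ∣ d → d ∣ q ^ f ∸ 1 → 1 ≤ f → f ∣ fbar → ¬ (4 ∣ q ^ fbar ∸ 1) → 𝒫 q d f ≡ true
  𝒫-holds {q} {d} {f} {fbar} q>0 2∣d d∣qᶠ∸1 f>0 (divides t refl) 4∤ = begin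
    does (2 ∣? d) ∧ not (does (4 ∣? d)) ∧ does (q % 4 ≟ 3) ∧ not (does (2 ∣? f))
      ≡⟨ cong₂ (λ a b → a ∧ not b ∧ does (q % 4 ≟ 3) ∧ not (does (2 ∣? f))) (dec-true (2 ∣? d) 2∣d) (dec-false (4 ∣? d) 4∤d) ⟩
    does (q % 4 ≟ 3) ∧ not (does (2 ∣? f))
      ≡⟨ cong₂ (λ a b → a ∧ not b) (dec-true (q % 4 ≟ 3) q%4≡3) (dec-false (2 ∣? f) 2∤f) ⟩
    true ∎
    where
    open ≡-Reasoning
    [qᶠ]ᵗ≡ : (q ^ f) ^ t ≡ q ^ (t * f)
    [qᶠ]ᵗ≡ = trans (^-*-assoc q f t) (cong (q ^_) (*-comm f t))
    4∤d : ¬ (4 ∣ d)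
    4∤d 4∣d = 4∤ (subst (λ n → 4 ∣ n ∸ 1) [qᶠ]ᵗ≡ (∣x∸1⇒∣x^n∸1 t (∣-trans 4∣d d∣qᶠ∸1)))
    2∤q : ¬ (2 ∣ q)
    2∤q 2∣q = ≥2⇒∤1 (s≤s (s≤s z≤n)) (∣m+n∣m⇒∣n (subst (2 ∣_) (sym (m∸n+n≡m (^>0 f q>0))) 2∣qᶠ) (∣-trans 2∣d d∣qᶠ∸1))
      where 2∣qᶠ = ∣-trans 2∣q (subst (_∣ q ^ f) (*-identityʳ q) (^-monoʳ-∣ q f>0))
    2∣q∸1 : 2 ∣ q ∸ 1
    2∣q∸1 with m , refl ← odd⇒≡1+2* 2∤q = divides m refl
    q%4≡3 : q % 4 ≡ 3
    q%4≡3 with q % 4 | m%n<n q 4 | m≡m%n+[m/n]*n q 4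
    ... | 0 | _ | q≡ = ⊥-elim (2∤q (divides ((q / 4) * 2) (trans q≡ (sym (*-assoc (q / 4) 2 2)))))
    ... | 1 | _ | q≡ = ⊥-elim (4∤ (∣x∸1⇒∣x^n∸1 (t * f) (divides (q / 4) (cong (_∸ 1) q≡))))
    ... | 2 | _ | q≡ = ⊥-elim (2∤q (divides (1 + (q / 4) * 2) (trans q≡ (regroup (q / 4)))))
      where
      regroup : ∀ s → 2 + s * 4 ≡ (1 + s * 2) * 2
      regroup = solve-∀
    ... | 3 | _ | _ = refl
    ... | suc (suc (suc (suc _))) | s≤s (s≤s (s≤s (s≤s ()))) | _
    2∤f : ¬ (2 ∣ f)
    2∤f (divides s refl) = 4∤ (subst (λ n → 4 ∣ n ∸ 1) [q²]ᵗˢ≡ (∣x∸1⇒∣x^n∸1 (t * s) (2∣x∸1⇒4∣x²∸1 {q} 2∣q∸1)))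
      where
      [q²]ᵗˢ≡ : (q ^ 2) ^ (t * s) ≡ q ^ (t * (s * 2))
      [q²]ᵗˢ≡ = trans (^-*-assoc q 2 (t * s)) (cong (q ^_) (trans (*-comm 2 (t * s)) (*-assoc t s 2)))

  -- η q d f f̄ unfolds to ηˣ (𝒫 q d f) (q ^ f̄).
  ηˣ : Bool → ℕ → ℕ → ℕ → ℕ
  ηˣ P x m n = if does (2 ∣? gcd m n) ∧ P then 2 ^ (v 2 (x + 1) ∸ 1) else 1

  ηˣ>0 : ∀ P x m n → 1 ≤ ηˣ P x m n
  ηˣ>0 P x m n with does (2 ∣? gcd m n) ∧ P
  ... | true  = ^>0 (v 2 (x + 1) ∸ 1) (s≤s z≤n)
  ... | false = s≤s z≤n

  ηˣ[m,1]≡1 : ∀ P x m → ηˣ P x m 1 ≡ 1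
  ηˣ[m,1]≡1 P x m = cong (λ g → if does (2 ∣? g) ∧ P then 2 ^ (v 2 (x + 1) ∸ 1) else 1) (gcd-zeroʳ m)

  ∣gcd⇒∣×∣ : ∀ {k} m n → k ∣ gcd m n → k ∣ m × k ∣ n
  ∣gcd⇒∣×∣ m n k∣g = ∣-trans k∣g (gcd[m,n]∣m m n) , ∣-trans k∣g (gcd[m,n]∣n m n)

  ηˣ-multiplicative : ∀ P x m → Multiplicative _*_ (ηˣ P x m)
  ηˣ-multiplicative P x m {a} {b} a⊥b _ _ = begin
    (if does (2 ∣? gcd m (a * b)) ∧ P then E else 1)   ≡⟨ cong (λ c → if c ∧ P then E else 1) (does-⇔ 2∣gcd[m,ab]⇔ (2 ∣? gcd m (a * b)) (2 ∣? gcd m a ⊎-dec 2 ∣? gcd m b)) ⟩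
    (if (A ∨ B) ∧ P then E else 1)                      ≡⟨ split A B P (dec-false (2 ∣? gcd m a ×-dec 2 ∣? gcd m b) not-both) ⟩
    (if A ∧ P then E else 1) * (if B ∧ P then E else 1) ∎
    where
    open ≡-Reasoning
    E = 2 ^ (v 2 (x + 1) ∸ 1)
    A = does (2 ∣? gcd m a)
    B = does (2 ∣? gcd m b)
    2∣gcd[m,ab]⇔ : 2 ∣ gcd m (a * b) ⇔ (2 ∣ gcd m a ⊎ 2 ∣ gcd m b)
    2∣gcd[m,ab]⇔ = mk⇔
      (λ 2∣g → let 2∣m , 2∣ab = ∣gcd⇒∣×∣ m (a * b) 2∣g in
        Sum.map (gcd-greatest 2∣m) (gcd-greatest 2∣m) (euclidsLemma a b prime[2] 2∣ab))
      [ (λ 2∣g → let 2∣m , 2∣a = ∣gcd⇒∣×∣ m a 2∣g in gcd-greatest 2∣m (∣m⇒∣m*n b 2∣a))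
      , (λ 2∣g → let 2∣m , 2∣b = ∣gcd⇒∣×∣ m b 2∣g in gcd-greatest 2∣m (∣n⇒∣m*n a 2∣b)) ]′
    not-both : ¬ (2 ∣ gcd m a × 2 ∣ gcd m b)
    not-both (2∣gcd[m,a] , 2∣gcd[m,b]) with () ← a⊥b (proj₂ (∣gcd⇒∣×∣ m a 2∣gcd[m,a]) , proj₂ (∣gcd⇒∣×∣ m b 2∣gcd[m,b]))
    split : ∀ A B Q → A ∧ B ≡ false → (if (A ∨ B) ∧ Q then E else 1) ≡ (if A ∧ Q then E else 1) * (if B ∧ Q then E else 1)
    split true  true  _     ()
    split true  false true  _ = sym (*-identityʳ E)
    split false true  true  _ = sym (+-identityʳ E)
    split false false true  _ = refl
    split true  false false _ = refl
    split false true  false _ = refl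
    split false false false _ = refl

  ηˣ≡1 : ∀ P x m n → ¬ (2 ∣ m) ⊎ ¬ (2 ∣ n) → ηˣ P x m n ≡ 1
  ηˣ≡1 P x m n odd = cong (λ c → if c ∧ P then 2 ^ (v 2 (x + 1) ∸ 1) else 1)
    (dec-false (2 ∣? gcd m n) λ 2∣g → let 2∣m , 2∣n = ∣gcd⇒∣×∣ m n 2∣g in [ (λ 2∤m → 2∤m 2∣m) , (λ 2∤n → 2∤n 2∣n) ]′ odd)

  v₂[x+1]≡1 : ∀ {y} → 4 ∣ y → v 2 (suc y + 1) ≡ 1
  v₂[x+1]≡1 {y} (divides a refl) = v-unique {2} 1 (s≤s (s≤s z≤n)) (factor a) (≥2⇒∤1+l* a (s≤s (s≤s z≤n)))
    where
    factor : ∀ a → suc (a * 4) + 1 ≡ 2 * 1 * (1 + 2 * a)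
    factor = solve-∀

  -- Three cases: 4 ∣ x − 1 (then v₂(x + 1) = 1), ν odd, and ν even, the only one where η may exceed 1.
  lte₂-η : ∀ {x ν} P → 2 ≤ x → 2 ∣ x ∸ 1 → 1 ≤ ν → (2 ∣ ν → ¬ (4 ∣ x ∸ 1) → P ≡ true) →
    ∃[ e ] ηˣ P x ν 2 ≡ 2 ^ e × v 2 (x ^ ν ∸ 1) ≡ v 2 (x ∸ 1) + v 2 ν + e
  lte₂-η {suc y} {ν} P x≥2@(s≤s y>0) 2∣y ν>0 P-holds with 4 ∣? y | 2 ∣? ν
  ... | yes 4∣y | _ = 0 , η≡1 , trans (lte prime[2] ν ν>0 x≥2 2∣y (inj₂ 4∣y)) (sym (+-identityʳ _))
    where
    η≡1 : ηˣ P (suc y) ν 2 ≡ 1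
    η≡1 with does (2 ∣? gcd ν 2) ∧ P
    ... | true  = cong (λ c → 2 ^ (c ∸ 1)) (v₂[x+1]≡1 4∣y)
    ... | false = refl
  ... | no 4∤y | no 2∤ν = 0 , ηˣ≡1 P (suc y) ν 2 (inj₁ 2∤ν) , (begin
    v 2 (suc y ^ ν ∸ 1)     ≡⟨ v-[x^n∸1]-l∤n ν prime[2] y>0 ν>0 2∣y 2∤ν ⟩
    v 2 y                   ≡⟨ sym (trans (cong (v 2 y +_) (v≡0 (s≤s (s≤s z≤n)) 2∤ν)) (+-identityʳ (v 2 y))) ⟩
    v 2 y + v 2 ν           ≡⟨ sym (+-identityʳ _) ⟩
    v 2 y + v 2 ν + 0       ∎)
    where open ≡-Reasoning
  ... | no 4∤y | yes (divides k refl) = c ∸ 1 , ηˣ≡ , (begin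
    v 2 (x ^ (k * 2) ∸ 1)           ≡⟨ v₂-lte-even k k>0 x≥2 2∣y ⟩
    v 2 y + c + v 2 k               ≡⟨ cong (λ z → v 2 y + z + v 2 k) (sym (m+[n∸m]≡n c>0)) ⟩
    v 2 y + (1 + (c ∸ 1)) + v 2 k   ≡⟨ regroup (v 2 y) (c ∸ 1) (v 2 k) ⟩
    v 2 y + (v 2 k + 1) + (c ∸ 1)   ≡⟨ cong (λ z → v 2 y + z + (c ∸ 1)) (sym v₂[k*2]) ⟩
    v 2 y + v 2 (k * 2) + (c ∸ 1)   ∎)
    where
    open ≡-Reasoning
    x = suc y
    c = v 2 (x + 1)
    k>0 : 1 ≤ k
    k>0 = n≢0⇒n>0 λ { refl → <⇒≱ ν>0 z≤n }
    ηˣ≡ : ηˣ P x (k * 2) 2 ≡ 2 ^ (c ∸ 1)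
    ηˣ≡ = cong₂ (λ b p → if b ∧ p then 2 ^ (c ∸ 1) else 1)
      (dec-true (2 ∣? gcd (k * 2) 2) (gcd-greatest (divides k refl) ∣-refl)) (P-holds (divides k refl) 4∤y)
    c>0 : 1 ≤ c
    c>0 = ^∣⇒≤v (s≤s (s≤s z≤n)) (subst (1 ≤_) (+-comm 1 x) (s≤s z≤n))
      (subst (2 ∣_) (trans (+-comm y 2) (sym (+-comm x 1))) (∣m∣n⇒∣m+n 2∣y (divides 1 refl)))
    v₂[k*2] : v 2 (k * 2) ≡ v 2 k + 1
    v₂[k*2] = trans (v-* k 2 prime[2] k>0 (s≤s z≤n)) (cong (v 2 k +_) (v-self {2} (s≤s (s≤s z≤n))))
    regroup : ∀ a b c → a + (1 + b) + c ≡ a + (c + 1) + b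
    regroup = solve-∀

  lte-η : ∀ {l x ν} P → Prime l → 2 ≤ x → l ∣ x ∸ 1 → 1 ≤ ν → (l ≡ 2 → 2 ∣ ν → ¬ (4 ∣ x ∸ 1) → P ≡ true) →
    ∃[ e ] ηˣ P x ν l ≡ l ^ e × v l (x ^ ν ∸ 1) ≡ v l (x ∸ 1) + v l ν + e
  lte-η {l} {x} {ν} P pl x≥2 l∣x∸1 ν>0 P-holds with 2 ∣? l
  ... | no 2∤l = 0 , ηˣ≡1 P x ν l (inj₂ 2∤l) , trans (lte pl ν ν>0 x≥2 l∣x∸1 (inj₁ 2∤l)) (sym (+-identityʳ _))
  ... | yes 2∣l with prime⇒irreducible pl 2∣l
  ...   | inj₂ refl = lte₂-η P x≥2 l∣x∸1 ν>0 (P-holds refl)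

module DeltaSum where

  open import Data.Nat using (ℕ; suc; _≤_; _<_; s≤s; z≤n; _^_)
  import Data.Nat as ℕ
  import Data.Nat.Properties as ℕ
  open import Data.Nat.Divisibility using (_∣_; ∣-trans; ∣-refl; ∣m⇒∣m*n)
  open import Data.Nat.GCD using (gcd; gcd-zeroˡ)
  open import Data.Nat.Coprimality using (Coprime)
  open import Data.Nat.Primality using (Prime; euclidsLemma)
  open import Data.Integer using (+_)
  import Data.Integer as ℤ
  import Data.Integer.Properties as ℤ
  open import Data.Rational using (ℚ; 0ℚ; 1ℚ; _*_; _-_)
  import Data.Rational.Properties as ℚ
  open import Data.List.Membership.Propositional using (_∈_)
  open import Algebra.Properties.CommutativeSemigroup ℕ.*-commutativeSemigroup using () renaming (interchange to ℕ*-interchange)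
  open import Algebra.Properties.CommutativeSemigroup ℤ.*-commutativeSemigroup using () renaming (interchange to ℤ*-interchange)
  open Sums
  open Valuation
  open PrimeFactors
  open CoprimeParts
  open Möbius using (μ-*)
  open Fractions
  open DivisorSums
  open Multiplicativity

  δ-term : ℕ → ℕ → ℕ → ℚ
  δ-term h u v′ = frac (μ u ℤ.* + gcd (u ℕ.* v′) h) (u ℕ.* v′)

  δ-sum : ℕ → ℕ → ℕ → ℚ
  δ-sum h D K = ∑[ v′ ∣ coprimePart K D ] ∑[ u ∣ D ] δ-term h u v′

  gcdFrac : ℕ → ℕ → ℚ
  gcdFrac h n = frac (+ gcd n h) n

  δ-term-* : ∀ h {u₁ u₂ v₁ v₂} → Coprime (u₁ ℕ.* v₁) (u₂ ℕ.* v₂) → 1 ≤ u₁ → 1 ≤ u₂ → 1 ≤ v₁ → 1 ≤ v₂ →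
    δ-term h (u₁ ℕ.* u₂) (v₁ ℕ.* v₂) ≡ δ-term h u₁ v₁ * δ-term h u₂ v₂
  δ-term-* h {u₁} {u₂} {v₁} {v₂} X⊥Y u₁>0 u₂>0 v₁>0 v₂>0 = begin
    frac (μ (u₁ ℕ.* u₂) ℤ.* + gcd ((u₁ ℕ.* u₂) ℕ.* (v₁ ℕ.* v₂)) h) ((u₁ ℕ.* u₂) ℕ.* (v₁ ℕ.* v₂))
      ≡⟨ cong (λ n → frac (μ (u₁ ℕ.* u₂) ℤ.* + gcd n h) n) (ℕ*-interchange u₁ u₂ v₁ v₂) ⟩
    frac (μ (u₁ ℕ.* u₂) ℤ.* + gcd (X ℕ.* Y) h) (X ℕ.* Y)
      ≡⟨ cong (λ z → frac z (X ℕ.* Y)) numerator ⟩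
    frac ((μ u₁ ℤ.* + gcd X h) ℤ.* (μ u₂ ℤ.* + gcd Y h)) (X ℕ.* Y)
      ≡⟨ frac-* _ _ (ℕ.*-mono-≤ u₁>0 v₁>0) (ℕ.*-mono-≤ u₂>0 v₂>0) ⟩
    δ-term h u₁ v₁ * δ-term h u₂ v₂ ∎
    where
    open ≡-Reasoning
    X = u₁ ℕ.* v₁
    Y = u₂ ℕ.* v₂
    u₁⊥u₂ : Coprime u₁ u₂
    u₁⊥u₂ = coprime-∣ X⊥Y (∣m⇒∣m*n v₁ ∣-refl) (∣m⇒∣m*n v₂ ∣-refl)
    numerator : μ (u₁ ℕ.* u₂) ℤ.* + gcd (X ℕ.* Y) h ≡ (μ u₁ ℤ.* + gcd X h) ℤ.* (μ u₂ ℤ.* + gcd Y h)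
    numerator = begin
      μ (u₁ ℕ.* u₂) ℤ.* + gcd (X ℕ.* Y) h           ≡⟨ cong₂ (λ m g → m ℤ.* + g) (μ-* u₁⊥u₂ u₁>0 u₂>0) (gcd-*-coprime X Y h X⊥Y) ⟩
      (μ u₁ ℤ.* μ u₂) ℤ.* + (gcd X h ℕ.* gcd Y h)   ≡⟨ cong (μ u₁ ℤ.* μ u₂ ℤ.*_) (ℤ.pos-* (gcd X h) (gcd Y h)) ⟩
      (μ u₁ ℤ.* μ u₂) ℤ.* (+ gcd X h ℤ.* + gcd Y h) ≡⟨ ℤ*-interchange (μ u₁) (μ u₂) (+ gcd X h) (+ gcd Y h) ⟩
      (μ u₁ ℤ.* + gcd X h) ℤ.* (μ u₂ ℤ.* + gcd Y h) ∎

  prime∣u*v⇒∣ : ∀ {K a u v′ p} → u ∣ a → v′ ∣ coprimePart K a → Prime p → p ∣ u ℕ.* v′ → p ∣ a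
  prime∣u*v⇒∣ {K} {a} {u} {v′} u∣a v′∣ pp p∣uv with euclidsLemma u v′ pp p∣uv
  ... | inj₁ p∣u = ∣-trans p∣u u∣a
  ... | inj₂ p∣v = prime∣coprimePart⇒∣ K a pp (∣-trans p∣v v′∣)

  δ-sum-multiplicative : ∀ h K → Multiplicative _*_ (λ D → δ-sum h D K)
  δ-sum-multiplicative h K {a} {b} a⊥b a>0 b>0 = begin
    ∑[ v′ ∣ coprimePart K (a ℕ.* b) ] ∑[ u ∣ a ℕ.* b ] δ-term h u v′
      ≡⟨ cong (λ n → ∑∣ n (λ v′ → ∑[ u ∣ a ℕ.* b ] δ-term h u v′)) (coprimePart-* K a⊥b a>0 b>0) ⟩
    ∑[ v′ ∣ Ka ℕ.* Kb ] ∑[ u ∣ a ℕ.* b ] δ-term h u v′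
      ≡⟨ ∑∣-* Ka⊥Kb (coprimePart>0 K a) (coprimePart>0 K b) _ ⟩
    ∑[ v₁ ∣ Ka ] ∑[ v₂ ∣ Kb ] ∑[ u ∣ a ℕ.* b ] δ-term h u (v₁ ℕ.* v₂)
      ≡⟨ ∑-cong (divisors Ka) (λ v₁∈ → ∑-cong (divisors Kb) (λ v₂∈ →
           trans (∑∣-* a⊥b a>0 b>0 _) (∑-cong (divisors a) (λ u₁∈ → ∑-cong (divisors b) (λ u₂∈ → split v₁∈ v₂∈ u₁∈ u₂∈))))) ⟩
    ∑[ v₁ ∣ Ka ] ∑[ v₂ ∣ Kb ] ∑[ u₁ ∣ a ] ∑[ u₂ ∣ b ] (δ-term h u₁ v₁ * δ-term h u₂ v₂)
      ≡⟨ ∑-cong (divisors Ka) (λ {v₁} _ → ∑-cong (divisors Kb) (λ {v₂} _ → sym (∑-*-∑ (divisors a) (divisors b) (λ u₁ → δ-term h u₁ v₁) _))) ⟩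
    ∑[ v₁ ∣ Ka ] ∑[ v₂ ∣ Kb ] ((∑[ u₁ ∣ a ] δ-term h u₁ v₁) * (∑[ u₂ ∣ b ] δ-term h u₂ v₂))
      ≡⟨ sym (∑-*-∑ (divisors Ka) (divisors Kb) _ _) ⟩
    δ-sum h a K * δ-sum h b K ∎
    where
    open ≡-Reasoning
    Ka = coprimePart K a
    Kb = coprimePart K b
    Ka⊥Kb : Coprime Ka Kb
    Ka⊥Kb = noCommonPrime⇒coprime λ pp p∣Ka p∣Kb →
      coprime⇒prime∤ a⊥b pp (prime∣coprimePart⇒∣ K a pp p∣Ka) (prime∣coprimePart⇒∣ K b pp p∣Kb)
    split : ∀ {v₁ v₂ u₁ u₂} → v₁ ∈ divisors Ka → v₂ ∈ divisors Kb → u₁ ∈ divisors a → u₂ ∈ divisors b →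
      δ-term h (u₁ ℕ.* u₂) (v₁ ℕ.* v₂) ≡ δ-term h u₁ v₁ * δ-term h u₂ v₂
    split {v₁} {v₂} {u₁} {u₂} v₁∈ v₂∈ u₁∈ u₂∈
      with v₁∣ , v₁>0 ← ∈divisors⁻ {Ka} v₁∈ | v₂∣ , v₂>0 ← ∈divisors⁻ {Kb} v₂∈
         | u₁∣ , u₁>0 ← ∈divisors⁻ {a} u₁∈ | u₂∣ , u₂>0 ← ∈divisors⁻ {b} u₂∈
      = δ-term-* h (noCommonPrime⇒coprime λ pp p∣X p∣Y →
          coprime⇒prime∤ a⊥b pp (prime∣u*v⇒∣ {K} u₁∣ v₁∣ pp p∣X) (prime∣u*v⇒∣ {K} u₂∣ v₂∣ pp p∣Y)) u₁>0 u₂>0 v₁>0 v₂>0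

  δ-sum-primePower : ∀ h K {l} a → Prime l → 1 ≤ a → δ-sum h (l ^ a) K ≡ 1ℚ - gcdFrac h (l ^ suc (v l K))
  δ-sum-primePower h K {l} (suc a) pl _ = begin
    ∑[ v′ ∣ coprimePart K (l ^ suc a) ] ∑[ u ∣ l ^ suc a ] δ-term h u v′
      ≡⟨ cong (λ n → ∑∣ n (λ v′ → ∑[ u ∣ l ^ suc a ] δ-term h u v′)) (coprimePart-primePower K (suc a) pl (s≤s z≤n)) ⟩
    ∑[ v′ ∣ l ^ b ] ∑[ u ∣ l ^ suc a ] δ-term h u v′   ≡⟨ ∑∣-primePower b pl _ ⟩
    ∑[ j < suc b ] ∑[ u ∣ l ^ suc a ] δ-term h u (l ^ j) ≡⟨ ∑<-cong (suc b) (λ j _ → inner j) ⟩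
    ∑[ j < suc b ] (gcdFrac h (l ^ j) - gcdFrac h (l ^ suc j)) ≡⟨ ∑<-telescope (suc b) (λ j → gcdFrac h (l ^ j)) ⟩
    gcdFrac h 1 - gcdFrac h (l ^ suc b)                 ≡⟨ cong (λ g → frac (+ g) 1 - gcdFrac h (l ^ suc b)) (gcd-zeroˡ h) ⟩
    1ℚ - gcdFrac h (l ^ suc b)                          ∎
    where
    open ≡-Reasoning
    b = v l K
    inner : ∀ j → ∑[ u ∣ l ^ suc a ] δ-term h u (l ^ j) ≡ gcdFrac h (l ^ j) - gcdFrac h (l ^ suc j)
    inner j = trans (∑∣-μ-primePower (λ u → gcd (u ℕ.* l ^ j) h) (λ u → u ℕ.* l ^ j) (suc a) pl (s≤s z≤n))
      (cong (_- gcdFrac h (l ^ suc j)) (cong (gcdFrac h) (ℕ.*-identityˡ (l ^ j))))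

  δ-sum-primePower≡0 : ∀ {h} K {l} a → Prime l → 1 ≤ a → 1 ≤ h → v l K < v l h → δ-sum h (l ^ a) K ≡ 0ℚ
  δ-sum-primePower≡0 {h} K {l} a pl a>0 h>0 b<c = begin
    δ-sum h (l ^ a) K                                   ≡⟨ δ-sum-primePower h K a pl a>0 ⟩
    1ℚ - frac (+ gcd (l ^ suc b) h) (l ^ suc b)         ≡⟨ cong (λ g → 1ℚ - frac (+ g) (l ^ suc b)) (gcd-≡ˡ (≤v⇒^∣ (prime⇒≥2 pl) h>0 b<c)) ⟩
    1ℚ - frac (+ (l ^ suc b)) (l ^ suc b)               ≡⟨ cong (1ℚ -_) (frac-self (^>0 (suc b) (ℕ.≤-trans (s≤s z≤n) (prime⇒≥2 pl)))) ⟩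
    1ℚ - 1ℚ                                             ≡⟨ ℚ.+-inverseʳ 1ℚ ⟩
    0ℚ                                                  ∎
    where
    open ≡-Reasoning
    b = v l K

open import Data.Nat using (ℕ; _*_; _^_; _≤_)
open import Data.Nat.Divisibility using (_∣_)
open import Data.Nat.Primality using (Prime)
open import Data.Nat.GCD using (gcd)
open import Data.Rational using (ℚ; 0ℚ)
open import Relation.Binary.PropositionalEquality using (_≢_)

module Setting
  {q d h f fbar w : ℕ} (q≥2 : 2 ≤ q) (d≥2 : 2 ≤ d) (h>0 : 1 ≤ h)
  (ord-f : IsOrd d q f) (ord-fbar : IsOrd (d * coprimePart h d) q fbar) (w∣d^∞ : w ∣ d ^∞) where

  open import Data.Nat
  open import Data.Nat.Properties
  open import Data.Nat.Divisibility
  open import Data.Nat.GCD using (gcd; gcd-zeroˡ)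
  open import Data.Nat.Primality using (Prime)
  open import Data.Bool using (true; if_then_else_)
  open import Data.Integer using (+_)
  import Data.Integer as ℤ
  open import Data.Rational using (ℚ; 0ℚ; 1ℚ)
  import Data.Rational as ℚ
  import Data.Rational.Properties as ℚ
  open import Data.List.Membership.Propositional using (_∈_; find)
  open import Data.List.Relation.Unary.Any using (any?)
  open import Data.List.Relation.Unary.All using (lookup)
  open import Data.List.Relation.Unary.All.Properties using (¬Any⇒All¬)
  open import Relation.Nullary.Decidable using (dec-true)
  open import Data.Nat.Tactic.RingSolver using (solve-∀)
  open import Function using (id)
  open Sums
  open Valuation
  open PrimeFactors
  open CoprimeParts
  open Fractions
  open DivisorSums
  open Multiplicativity
  open Powers
  open Eta
  open DeltaSum

  q>0 : 1 ≤ q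
  q>0 = ≤-trans (s≤s z≤n) q≥2

  d>0 : 1 ≤ d
  d>0 = ≤-trans (s≤s z≤n) d≥2

  N : ℕ
  N = f * w

  K : ℕ
  K = (q ^ N ∸ 1) div d

  d*K≡ : d * K ≡ q ^ N ∸ 1
  d*K≡ = div-exact d>0 (ord∣⇒∣ {N = N} ord-f (∣m⇒∣m*n w ∣-refl))

  K>0 : 1 ≤ K
  K>0 = n≢0⇒n>0 λ K≡0 → <⇒≢ qᴺ∸1>0 (sym (trans (sym d*K≡) (trans (cong (d *_) K≡0) (*-zeroʳ d))))
    where
    qᴺ∸1>0 : 1 ≤ q ^ N ∸ 1
    qᴺ∸1>0 = ∸-monoˡ-≤ 1 (≤-trans q≥2 (m≤m^n N q>0 (*-mono-≤ (proj₁ ord-f) (∣^∞⇒>0 d>0 w∣d^∞))))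

  x≥2 : 2 ≤ q ^ fbar
  x≥2 = ≤-trans q≥2 (m≤m^n fbar q>0 (proj₁ ord-fbar))

  d∣x∸1 : d ∣ q ^ fbar ∸ 1
  d∣x∸1 = ∣-trans (m∣m*n (coprimePart h d)) (proj₁ (proj₂ ord-fbar))

  f∣fbar : f ∣ fbar
  f∣fbar = ord∣ ord-f q>0 d∣x∸1

  𝒫-holds-at : ∀ {l ν} → l ∣ d → l ≡ 2 → 2 ∣ ν → ¬ (4 ∣ q ^ fbar ∸ 1) → 𝒫 q d f ≡ true
  𝒫-holds-at l∣d refl _ 4∤ = 𝒫-holds q>0 l∣d (proj₁ (proj₂ ord-f)) (proj₁ ord-f) f∣fbar 4∤

  δ≡δ-sum : ∀ {F} → (∀ u v → u ∣ d → v ∣ d ^∞ → IsOrd (d * v) q (F u v)) → δ q d h f F w ≡ δ-sum h d K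
  δ≡δ-sum {F} ord-F = ∑-cong (divisors (coprimePart K d)) λ {v′} v′∈ → ∑-cong (divisors d) λ {u} u∈ →
    cong (λ b → if b then δ-term h u v′ else 0ℚ) (dec-true (F u v′ ∣? N) (F∣N v′∈ u∈))
    where
    F∣N : ∀ {v′ u} → v′ ∈ divisors (coprimePart K d) → u ∈ divisors d → F u v′ ∣ N
    F∣N {v′} {u} v′∈ u∈ with v′∣ , _ ← ∈divisors⁻ {coprimePart K d} v′∈ =
      ord∣ {N = N} (ord-F u v′ (proj₁ (∈divisors⁻ {d} u∈)) (∣-∣^∞ v′∣ (coprimePart∣^∞ K d))) q>0
        (subst (d * v′ ∣_) d*K≡ (*-monoʳ-∣ d (∣-trans v′∣ (coprimePart∣self d K>0))))

  module _ {ν} (ν∣d^∞ : ν ∣ d ^∞) (fw≡fbarν : f * w ≡ fbar * ν) where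

    Nᵣ : ℕ → ℕ
    Nᵣ = coprimePart (d * h)

    Dᵣ : ℕ → ℕ
    Dᵣ u = u * coprimePart (q ^ fbar ∸ 1) u * coprimePart ν u * η q d f fbar ν u

    R : ℕ → ℚ
    R u = frac (μ u ℤ.* + Nᵣ u) (Dᵣ u)

    R-multiplicative : Multiplicative ℚ._*_ R
    R-multiplicative = μ-frac-multiplicative {N = Nᵣ} {D = Dᵣ} (coprimePart-* (d * h))
      (*-multiplicative {f = λ u → u * coprimePart (q ^ fbar ∸ 1) u * coprimePart ν u} {g = ηˣ (𝒫 q d f) (q ^ fbar) ν}
        (*-multiplicative {f = λ u → u * coprimePart (q ^ fbar ∸ 1) u} {g = coprimePart ν}
          (*-multiplicative {f = id} {g = coprimePart (q ^ fbar ∸ 1)} id-multiplicative (coprimePart-* (q ^ fbar ∸ 1)))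
          (coprimePart-* ν))
        (ηˣ-multiplicative (𝒫 q d f) (q ^ fbar) ν))
      λ {u} u>0 → *-mono-≤ (*-mono-≤ (*-mono-≤ u>0 (coprimePart>0 (q ^ fbar ∸ 1) u)) (coprimePart>0 ν u)) (ηˣ>0 (𝒫 q d f) (q ^ fbar) ν u)

    R₁ : frac (+ Nᵣ 1) (Dᵣ 1) ≡ 1ℚ
    R₁ = cong (λ z → frac (+ 1) (1 * 1 * 1 * z)) (ηˣ[m,1]≡1 (𝒫 q d f) (q ^ fbar) ν)

    d*K≡xᵛ∸1 : d * K ≡ (q ^ fbar) ^ ν ∸ 1
    d*K≡xᵛ∸1 = trans d*K≡ (cong (_∸ 1) (trans (cong (q ^_) fw≡fbarν) (sym (^-*-assoc q fbar ν))))

    coprimePart∣K : coprimePart h d ∣ K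
    coprimePart∣K = *-cancelˡ-∣ d {{>-nonZero d>0}}
      (subst (d * coprimePart h d ∣_) (sym d*K≡xᵛ∸1) (∣x∸1⇒∣x^n∸1 ν (proj₁ (proj₂ ord-fbar))))

    local-factor : ∀ {l} → Prime l → l ∣ d → gcdFrac h (l ^ suc (v l K)) ≡ frac (+ Nᵣ l) (Dᵣ l)
    local-factor {l} pl l∣d
      with e , η≡lᵉ , v≡ ← lte-η (𝒫 q d f) pl x≥2 (∣-trans l∣d d∣x∸1) (∣^∞⇒>0 d>0 ν∣d^∞) (𝒫-holds-at l∣d) = begin
      frac (+ gcd (l ^ suc b) h) (l ^ suc b)            ≡⟨ cong (λ g → frac (+ g) (l ^ suc b)) (gcd-^ {h = h} (suc b) pl h>0 (m≤n⇒m≤1+n c≤b)) ⟩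
      frac (+ (l ^ c)) (l ^ suc b)                      ≡⟨ frac-^-cross l {c} {suc b} {vd + c} {1 + X + n + e} l>0 exponents ⟩
      frac (+ (l ^ (vd + c))) (l ^ (1 + X + n + e))     ≡⟨ sym (cong₂ (λ a b → frac (+ a) b) Nᵣl≡ Dᵣl≡) ⟩
      frac (+ Nᵣ l) (Dᵣ l)                              ∎
      where
      open ≡-Reasoning
      l≥2 = prime⇒≥2 pl
      l>0 = ≤-trans (s≤s z≤n) l≥2
      b = v l K
      c = v l h
      vd = v l d
      X = v l (q ^ fbar ∸ 1)
      n = v l ν
      c≤b : c ≤ b
      c≤b = ^∣⇒≤v {k = K} {j = c} l≥2 K>0 (∣-trans (^v∣coprimePart h pl d>0 l∣d) coprimePart∣K)
      vd+b≡ : vd + b ≡ X + n + e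
      vd+b≡ = trans (sym (v-* d K pl d>0 K>0)) (trans (cong (v l) d*K≡xᵛ∸1) v≡)
      exponents : c + (1 + X + n + e) ≡ vd + c + suc b
      exponents = begin
        c + (1 + X + n + e)  ≡⟨ regroup₁ c X n e ⟩
        c + 1 + (X + n + e)  ≡⟨ cong (_+_ (c + 1)) (sym vd+b≡) ⟩
        c + 1 + (vd + b)     ≡⟨ regroup₂ c vd b ⟩
        vd + c + suc b       ∎
        where
        regroup₁ : ∀ c X n e → c + (1 + X + n + e) ≡ c + 1 + (X + n + e)
        regroup₁ = solve-∀
        regroup₂ : ∀ c vd b → c + 1 + (vd + b) ≡ vd + c + suc b
        regroup₂ = solve-∀
      Nᵣl≡ : Nᵣ l ≡ l ^ (vd + c)
      Nᵣl≡ = trans (coprimePart-prime (d * h) pl) (cong (l ^_) (v-* d h pl d>0 h>0))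
      Dᵣl≡ : Dᵣ l ≡ l ^ (1 + X + n + e)
      Dᵣl≡ = begin
        l * coprimePart (q ^ fbar ∸ 1) l * coprimePart ν l * η q d f fbar ν l
          ≡⟨ cong₂ (λ A B → l * A * B * η q d f fbar ν l) (coprimePart-prime (q ^ fbar ∸ 1) pl) (coprimePart-prime ν pl) ⟩
        l * l ^ X * l ^ n * η q d f fbar ν l      ≡⟨ cong (l * l ^ X * l ^ n *_) η≡lᵉ ⟩
        l ^ (1 + X) * l ^ n * l ^ e               ≡⟨ cong (_* l ^ e) (sym (^-distribˡ-+-* l (1 + X) n)) ⟩
        l ^ (1 + X + n) * l ^ e                   ≡⟨ sym (^-distribˡ-+-* l (1 + X + n) e) ⟩
        l ^ (1 + X + n + e)                       ∎

    δ-sum≡rhs : δ-sum h d K ≡ rhs q d h f fbar ν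
    δ-sum≡rhs = multiplicative-≡ {G = λ D → δ-sum h D K} {H = λ D → ∑[ u ∣ D ] R u}
      (δ-sum-multiplicative h K) (∑∣-multiplicative R-multiplicative)
      (trans δ-sum[1] (sym (trans (ℚ.+-identityʳ _) R₁))) d>0 agree
      where
      δ-sum[1] : δ-sum h 1 K ≡ 1ℚ
      δ-sum[1] = cong (λ g → frac (+ 1 ℤ.* + g) 1 ℚ.+ 0ℚ ℚ.+ 0ℚ) (gcd-zeroˡ h)
      agree : ∀ {l} → Prime l → l ∣ d → δ-sum h (l ^ v l d) K ≡ ∑[ u ∣ l ^ v l d ] R u
      agree {l} pl l∣d = begin
        δ-sum h (l ^ v l d) K                             ≡⟨ δ-sum-primePower h K (v l d) pl vd>0 ⟩
        1ℚ ℚ.- gcdFrac h (l ^ suc (v l K))                ≡⟨ cong₂ ℚ._-_ (sym R₁) (local-factor pl l∣d) ⟩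
        frac (+ Nᵣ 1) (Dᵣ 1) ℚ.- frac (+ Nᵣ l) (Dᵣ l)     ≡⟨ sym (∑∣-μ-primePower Nᵣ Dᵣ (v l d) pl vd>0) ⟩
        ∑[ u ∣ l ^ v l d ] R u                            ∎
        where
        open ≡-Reasoning
        vd>0 = ∣⇒v≥1 (prime⇒≥2 pl) d>0 l∣d

  ∃ν : (∀ {l} → Prime l → l ∣ d → v l h ≤ v l K) → ∃[ ν ] ν ∣ d ^∞ × f * w ≡ fbar * ν
  ∃ν v≤v
    with divides t N≡t*fbar ← ord∣ {N = N} ord-fbar q>0 (subst (d * coprimePart h d ∣_) d*K≡ (*-monoʳ-∣ d (coprimePart∣ {h} {d} K>0 v≤v)))
       | divides s refl ← f∣fbar
    = t , ∣-∣^∞ (divides s w≡s*t) w∣d^∞ , trans N≡t*fbar (*-comm t (s * f))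
    where
    w≡s*t : w ≡ s * t
    w≡s*t = *-cancelˡ-≡ w (s * t) f {{>-nonZero (proj₁ ord-f)}} (trans N≡t*fbar (regroup t s f))
      where
      regroup : ∀ t s f → t * (s * f) ≡ f * (s * t)
      regroup = solve-∀

  δ-sum≡0 : (∀ ν → ν ∣ d ^∞ → f * w ≢ fbar * ν) → δ-sum h d K ≡ 0ℚ
  δ-sum≡0 no-ν with any? (λ l → v l K <? v l h) (primeDivisors d)
  ... | yes some with l , l∈ , b<c ← find some with pl , l∣d ← ∈primeDivisors⁻ {d} l∈ =
    multiplicative-zero {G = λ D → δ-sum h D K} (δ-sum-multiplicative h K) d>0 pl l∣d
      (δ-sum-primePower≡0 K (v l d) pl (∣⇒v≥1 (prime⇒≥2 pl) d>0 l∣d) h>0 b<c)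
  ... | no none with ν , ν∣d^∞ , fw≡ ← ∃ν (λ pl l∣d → ≮⇒≥ (lookup (¬Any⇒All¬ _ none) (∈primeDivisors⁺ d>0 pl l∣d))) =
    ⊥-elim (no-ν ν ν∣d^∞ fw≡)

proposition8p1 : (p k q d h f fbar : ℕ) → (F : ℕ → ℕ → ℕ) →
    Prime p → 1 ≤ k → q ≡ p ^ k → 2 ≤ d → ¬ (p ∣ d) → 1 ≤ h →
    IsOrd d q f → IsOrd (d * coprimePart h d) q fbar →
    (∀ u v → u ∣ d → v ∣ d ^∞ → IsOrd (d * v) q (F u v)) →
    ∀ w → w ∣ d ^∞ →
      ((∀ ν → ν ∣ d ^∞ → f * w ≡ fbar * ν → δ q d h f F w ≡ rhs q d h f fbar ν)
      × ((∀ ν → ν ∣ d ^∞ → f * w ≢ fbar * ν) → δ q d h f F w ≡ 0ℚ))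
proposition8p1 p k q d h f fbar F p-prime k≥1 q≡pᵏ d≥2 _ h≥1 ord-f ord-fbar ord-F w w∣d^∞ =
  (λ ν ν∣d^∞ fw≡fbarν → trans (δ≡δ-sum ord-F) (δ-sum≡rhs ν∣d^∞ fw≡fbarν)) ,
  (λ no-ν → trans (δ≡δ-sum ord-F) (δ-sum≡0 no-ν))
  where open Setting (subst (2 ≤_) (sym q≡pᵏ) (Valuation.primePower≥2 p-prime k≥1)) d≥2 h≥1 ord-f ord-fbar w∣d^∞
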